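{- Let $\lambda\in\mathbb{C}$ with $\lambda\neq 1$, let $\alpha\in\mathbb{C}$, let $c\in\mathbb{C}$ with $c\neq 0$, and let $S_n(x)\sim\left(\left(\frac{e^{(\lambda-1)t}-\lambda}{1-\lambda}\right)^{\alpha},\frac{t^2(1+t)^c}{\log(1+t)}\right)$. Then for $n\geq 1$, \[ S_n(x)=\sum_{l=0}^{n-1}\binom{n-1}{l}N_l^{(n)}(-nc)\,A_{n-l}^{(\alpha)}(x\mid\lambda). \]
   Context: For formal power series $g(t),f(t)$ over $\mathbb{C}$ with $g$ having nonzero constant term and $f$ having zero constant term and nonzero coefficient of $t$, the Sheffer sequence $S_n(x)\sim(g(t),f(t))$ is the sequence of polynomials defined by $\frac{1}{g(\bar f(t))}e^{y\bar f(t)}=\sum_{k\ge0}S_k(y)\frac{t^k}{k!}$, where $\bar f$ is the compositional inverse of $f$ (equivalently, the unique polynomials with $\langle g(t)f(t)^k\mid S_n(x)\rangle=n!\delta_{n,k}$, where $\langle \sum_k a_k t^k/k!\mid x^n\rangle=a_n$). The Narumi polynomials are defined by $\left(\frac{\log(1+t)}{t}\right)^a(1+t)^x=\sum_{n\ge0}N_n^{(a)}(x)\frac{t^n}{n!}$. The Frobenius-type Eulerian polynomials of order $a$ are defined by $\left(\frac{1-\lambda}{e^{t(\lambda-1)}-\lambda}\right)^a e^{xt}=\sum_{n\ge0}A_n^{(a)}(x\mid\lambda)\frac{t^n}{n!}$. -}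

module Defs where

open import Level using (Level; _⊔_) renaming (suc to lsuc)
open import Algebra.Bundles using (CommutativeRing)
open import Data.Nat using (ℕ; zero; suc; _∸_; _≡ᵇ_)
open import Data.Nat.Combinatorics using (_C_)
open import Data.Bool using (if_then_else_)
open import Data.List using (List; []; _∷_)
open import Relation.Nullary using (¬_)

module _ {c ℓ : Level} (R : CommutativeRing c ℓ) where
  open CommutativeRing R
  ιR : ℕ → Carrier
  ιR zero = 0#
  ιR (suc n) = 1# + ιR n

-- A field of characteristic zero (stand-in for ℂ).
-- The inverse is a total function; it is only constrained on nonzero elements.
record CharZeroField (c ℓ : Level) : Set (lsuc (c ⊔ ℓ)) where
  field
    commutativeRing : CommutativeRing c ℓ
  open CommutativeRing commutativeRing public
  field
    _⁻¹       : Carrier → Carrier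
    ⁻¹-inverse : ∀ x → ¬ (x ≈ 0#) → x * (x ⁻¹) ≈ 1#
    char0      : ∀ n → ¬ (ιR commutativeRing (suc n) ≈ 0#)

module FPS {c ℓ : Level} (F : CharZeroField c ℓ) where
  open CharZeroField F

  ι : ℕ → Carrier
  ι = ιR commutativeRing

  sumTo : ℕ → (ℕ → Carrier) → Carrier
  sumTo zero a = 0#
  sumTo (suc n) a = sumTo n a + a n

  _^ᶜ_ : Carrier → ℕ → Carrier
  x ^ᶜ zero = 1#
  x ^ᶜ suc k = x * (x ^ᶜ k)

  fact : ℕ → Carrier
  fact zero = 1#
  fact (suc n) = ι (suc n) * fact n

  -- formal power series: coefficient sequences  h(t) = Σ h n t^n
  Series : Set c
  Series = ℕ → Carrier

  const : Carrier → Series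
  const a zero = a
  const a (suc n) = 0#

  _⊕_ : Series → Series → Series
  (a ⊕ b) n = a n + b n

  _⊖_ : Series → Series → Series
  (a ⊖ b) n = a n - b n

  scale : Carrier → Series → Series
  scale r a n = r * a n

  _⊛_ : Series → Series → Series
  (a ⊛ b) n = sumTo (suc n) (λ i → a i * b (n ∸ i))

  powN : Series → ℕ → Series
  powN a zero = const 1#
  powN a (suc k) = a ⊛ powN a k

  mulT : Series → Series
  mulT a zero = 0#
  mulT a (suc n) = a n

  -- composition F(G(t)), meaningful when G has zero constant term
  compose : Series → Series → Series
  compose A G n = sumTo (suc n) (λ k → A k * powN G k n)

  expS : Carrier → Series
  expS a k = (a ^ᶜ k) * (fact k ⁻¹)

  logS : Series
  logS zero = 0#
  logS (suc k) = ((- 1#) ^ᶜ k) * (ι (suc k) ⁻¹)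

  logDivT : Series
  logDivT k = logS (suc k)

  falling : Carrier → ℕ → Carrier
  falling a zero = 1#
  falling a (suc k) = falling a k * (a - ι k)

  binomS : Carrier → Series
  binomS a k = falling a k * (fact k ⁻¹)

  -- logarithm of a series with constant term 1:  log h = log(1+t) ∘ (h - 1)
  logOf : Series → Series
  logOf h = compose logS (h ⊖ const 1#)

  -- h^a := exp(a log h) for a series h with constant term 1
  powS : Series → Carrier → Series
  powS h a = compose (expS 1#) (scale a (logOf h))

  recip : Series → Series
  recip h = powS h (- 1#)

  -- umbral pairing  < h(t) | p(x) > = Σ_j j! [t^j]h · [x^j]p
  -- polynomials are coefficient lists, lowest degree first
  Poly : Set c
  Poly = List Carrier

  pairFrom : ℕ → Series → Poly → Carrier
  pairFrom j h [] = 0#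
  pairFrom j h (p ∷ ps) = (fact j * h j) * p + pairFrom (suc j) h ps

  ⟨_∣_⟩ : Series → Poly → Carrier
  ⟨ h ∣ p ⟩ = pairFrom 0 h p

  eval : Poly → Carrier → Carrier
  eval [] x = 0#
  eval (p ∷ ps) x = p + x * eval ps x

  factδ : ℕ → ℕ → Carrier
  factδ n k = if n ≡ᵇ k then fact n else 0#

  IsSheffer : Series → Series → (ℕ → Poly) → Set ℓ
  IsSheffer g f S = ∀ n k → ⟨ g ⊛ powN f k ∣ S n ⟩ ≈ factδ n k

  -- Narumi polynomials:  (log(1+t)/t)^a (1+t)^x = Σ N_n^{(a)}(x) t^n/n!
  narumi : ℕ → Carrier → Carrier → Carrier
  narumi n a x = fact n * (powS logDivT a ⊛ binomS x) n

  eulerBase : Carrier → Series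
  eulerBase lam = scale ((1# - lam) ⁻¹) (expS (lam - 1#) ⊖ const lam)

  -- Frobenius-type Eulerian polynomials of order a:
  -- ((1-λ)/(e^{t(λ-1)}-λ))^a e^{xt} = Σ A_n^{(a)}(x|λ) t^n/n!
  frobEuler : ℕ → Carrier → Carrier → Carrier → Carrier
  frobEuler n a x lam = fact n * (powS (recip (eulerBase lam)) a ⊛ expS x) n

  gSeries : Carrier → Carrier → Series
  gSeries lam α = powS (eulerBase lam) α

  -- f(t) = t^2 (1+t)^c / log(1+t) = t (1+t)^c (log(1+t)/t)^{-1}
  fSeries : Carrier → Series
  fSeries cc = mulT (binomS cc ⊛ recip logDivT)

  rhs : ℕ → Carrier → Carrier → Carrier → Carrier → Carrier
  rhs n lam α cc x =
    sumTo n (λ l → (ι ((n ∸ 1) C l) * narumi l (ι n) (- (ι n * cc)))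
                   * frobEuler (n ∸ l) α x lam)

module Submission where

-- Write f = t·E with E = (1+t)^c (log(1+t)/t)^{-1} and, for n = m+1,
-- let H = (log(1+t)/t)^n (1+t)^{-nc}, so that H·E^n = 1.  The Lagrange-type
-- coefficient lemma gives  [t^m] H·(f^k)' = n·δ_{n,k}.  Since the Narumi
-- numbers are N_l^{(n)}(-nc) = l!·[t^l]H and the Eulerian polynomials are the
-- coefficients of (1/g)·e^{xt}, unfolding this identity says exactly that the
-- right-hand side P_n satisfies ⟨ g f^k | P_n ⟩ = n!·δ_{n,k} for every k.  The
-- series g f^k are triangular (order k, leading coefficient 1), so these
-- conditions determine the coefficients of S_n, hence S_n = P_n.

open import Defs
open import Data.Nat using (ℕ; _≤_; suc; s≤s)
open import Relation.Nullary using (¬_)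
open import Algebra.Bundles using (CommutativeRing; RawRing)

-- The ring solver of the standard library, instantiated for an arbitrary
-- commutative ring with integer coefficients; this needs the canonical ring
-- morphism ℤ → R, constructed here.
module IntegerRingSolver {c ℓ} (R : CommutativeRing c ℓ) where
  open import Data.Nat as ℕ using (zero)
  open import Data.Integer as ℤ using (ℤ; +_; -[1+_]; _⊖_; sign; ∣_∣; _◃_)
  import Data.Integer.Properties as ℤP
  open import Data.Sign as Sign using (Sign)
  open import Data.Maybe using (Maybe; just; nothing)
  open import Relation.Binary.PropositionalEquality as P using (_≡_)
  open import Relation.Nullary using (yes; no)
  open import Algebra.Solver.Ring.AlmostCommutativeRing
  open CommutativeRing R
  open import Relation.Binary.Reasoning.Setoid setoid
  open import Algebra.Properties.Ring ring
    using (-‿involutive; -0#≈0#; -‿anti-homo-+; -1*x≈-x)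

  -- n ↦ 1 + ... + 1, normalised so that the image of 1 is literally 1#
  ιn : ℕ → Carrier
  ιn zero = 0#
  ιn (suc zero) = 1#
  ιn (suc (suc n)) = 1# + ιn (suc n)

  ιn-suc : ∀ n → ιn (suc n) ≈ 1# + ιn n
  ιn-suc zero = sym (+-identityʳ _)
  ιn-suc (suc n) = refl

  ιn-+ : ∀ m n → ιn (m ℕ.+ n) ≈ ιn m + ιn n
  ιn-+ zero n = sym (+-identityˡ _)
  ιn-+ (suc m) n = begin
    ιn (suc (m ℕ.+ n))   ≈⟨ ιn-suc (m ℕ.+ n) ⟩
    1# + ιn (m ℕ.+ n)    ≈⟨ +-congˡ (ιn-+ m n) ⟩
    1# + (ιn m + ιn n)   ≈⟨ sym (+-assoc _ _ _) ⟩
    (1# + ιn m) + ιn n   ≈⟨ +-congʳ (sym (ιn-suc m)) ⟩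
    ιn (suc m) + ιn n    ∎

  ιn-* : ∀ m n → ιn (m ℕ.* n) ≈ ιn m * ιn n
  ιn-* zero n = sym (zeroˡ _)
  ιn-* (suc m) n = begin
    ιn (n ℕ.+ m ℕ.* n)       ≈⟨ ιn-+ n (m ℕ.* n) ⟩
    ιn n + ιn (m ℕ.* n)      ≈⟨ +-cong (sym (*-identityˡ _)) (ιn-* m n) ⟩
    1# * ιn n + ιn m * ιn n  ≈⟨ sym (distribʳ _ _ _) ⟩
    (1# + ιn m) * ιn n       ≈⟨ *-congʳ (sym (ιn-suc m)) ⟩
    ιn (suc m) * ιn n        ∎

  ⟦_⟧ℤ : ℤ → Carrier
  ⟦ + n ⟧ℤ = ιn n
  ⟦ -[1+ n ] ⟧ℤ = - ιn (suc n)

  ⊖-homo : ∀ m n → ⟦ m ⊖ n ⟧ℤ ≈ ιn m - ιn n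
  ⊖-homo m zero = sym (trans (+-congˡ -0#≈0#) (+-identityʳ _))
  ⊖-homo zero (suc n) = sym (+-identityˡ _)
  ⊖-homo (suc m) (suc n) = begin
    ⟦ suc m ⊖ suc n ⟧ℤ            ≈⟨ reflexive (P.cong ⟦_⟧ℤ (ℤP.[1+m]⊖[1+n]≡m⊖n m n)) ⟩
    ⟦ m ⊖ n ⟧ℤ                    ≈⟨ ⊖-homo m n ⟩
    ιn m - ιn n                   ≈⟨ add-one ⟩
    (1# + ιn m) - (1# + ιn n)     ≈⟨ sym (+-cong (ιn-suc m) (-‿cong (ιn-suc n))) ⟩
    ιn (suc m) - ιn (suc n)       ∎
    where
    add-one : ιn m - ιn n ≈ (1# + ιn m) - (1# + ιn n)
    add-one = begin
      ιn m - ιn n                   ≈⟨ sym (+-identityˡ _) ⟩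
      0# + (ιn m - ιn n)            ≈⟨ +-congʳ (sym (-‿inverseʳ 1#)) ⟩
      (1# - 1#) + (ιn m - ιn n)     ≈⟨ +-assoc _ _ _ ⟩
      1# + (- 1# + (ιn m - ιn n))   ≈⟨ +-congˡ (trans (sym (+-assoc _ _ _))
                                         (trans (+-congʳ (+-comm _ _)) (+-assoc _ _ _))) ⟩
      1# + (ιn m + (- 1# - ιn n))   ≈⟨ sym (+-assoc _ _ _) ⟩
      (1# + ιn m) + (- 1# - ιn n)   ≈⟨ +-congˡ (trans (sym (-‿anti-homo-+ _ _)) (-‿cong (+-comm _ _))) ⟩
      (1# + ιn m) - (1# + ιn n)     ∎

  ⟦_⟧sign : Sign → Carrier
  ⟦ Sign.+ ⟧sign = 1#
  ⟦ Sign.- ⟧sign = - 1#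

  ◃-homo : ∀ s n → ⟦ s ◃ n ⟧ℤ ≈ ⟦ s ⟧sign * ιn n
  ◃-homo s zero = sym (zeroʳ _)
  ◃-homo Sign.+ (suc n) = sym (*-identityˡ _)
  ◃-homo Sign.- (suc n) = sym (-1*x≈-x _)

  sign-abs : ∀ i → ⟦ i ⟧ℤ ≈ ⟦ sign i ⟧sign * ιn ∣ i ∣
  sign-abs i = trans (reflexive (P.cong ⟦_⟧ℤ (P.sym (ℤP.◃-inverse i)))) (◃-homo (sign i) ∣ i ∣)

  sign-*-homo : ∀ s t → ⟦ s Sign.* t ⟧sign ≈ ⟦ s ⟧sign * ⟦ t ⟧sign
  sign-*-homo Sign.- Sign.- = sym (trans (-1*x≈-x _) (-‿involutive _))
  sign-*-homo Sign.- Sign.+ = sym (*-identityʳ _)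
  sign-*-homo Sign.+ Sign.- = sym (*-identityˡ _)
  sign-*-homo Sign.+ Sign.+ = sym (*-identityˡ _)

  *-interchange : ∀ a b x y → (a * b) * (x * y) ≈ (a * x) * (b * y)
  *-interchange a b x y = begin
    (a * b) * (x * y)  ≈⟨ *-assoc _ _ _ ⟩
    a * (b * (x * y))  ≈⟨ *-congˡ (trans (sym (*-assoc _ _ _)) (trans (*-congʳ (*-comm _ _)) (*-assoc _ _ _))) ⟩
    a * (x * (b * y))  ≈⟨ sym (*-assoc _ _ _) ⟩
    (a * x) * (b * y)  ∎

  *-homo : ∀ i j → ⟦ i ℤ.* j ⟧ℤ ≈ ⟦ i ⟧ℤ * ⟦ j ⟧ℤ
  *-homo i j = begin
    ⟦ i ℤ.* j ⟧ℤ                                          ≈⟨ ◃-homo (sign i Sign.* sign j) (∣ i ∣ ℕ.* ∣ j ∣) ⟩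
    ⟦ sign i Sign.* sign j ⟧sign * ιn (∣ i ∣ ℕ.* ∣ j ∣)   ≈⟨ *-cong (sign-*-homo (sign i) (sign j)) (ιn-* ∣ i ∣ ∣ j ∣) ⟩
    (⟦ sign i ⟧sign * ⟦ sign j ⟧sign) * (ιn ∣ i ∣ * ιn ∣ j ∣)  ≈⟨ *-interchange _ _ _ _ ⟩
    (⟦ sign i ⟧sign * ιn ∣ i ∣) * (⟦ sign j ⟧sign * ιn ∣ j ∣)  ≈⟨ *-cong (sym (sign-abs i)) (sym (sign-abs j)) ⟩
    ⟦ i ⟧ℤ * ⟦ j ⟧ℤ                                        ∎

  neg-homo : ∀ i → ⟦ ℤ.- i ⟧ℤ ≈ - ⟦ i ⟧ℤ
  neg-homo -[1+ n ] = sym (-‿involutive _)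
  neg-homo (+ zero) = sym -0#≈0#
  neg-homo (+ suc n) = refl

  +-homo : ∀ i j → ⟦ i ℤ.+ j ⟧ℤ ≈ ⟦ i ⟧ℤ + ⟦ j ⟧ℤ
  +-homo -[1+ m ] -[1+ n ] = begin
    - ιn (suc (suc (m ℕ.+ n)))     ≈⟨ -‿cong (trans (ιn-suc (suc (m ℕ.+ n))) (+-congˡ (ιn-+ (suc m) n))) ⟩
    - (1# + (ιn (suc m) + ιn n))   ≈⟨ -‿cong (trans (sym (+-assoc _ _ _)) (trans (+-congʳ (+-comm _ _)) (+-assoc _ _ _))) ⟩
    - (ιn (suc m) + (1# + ιn n))   ≈⟨ -‿cong (+-congˡ (sym (ιn-suc n))) ⟩
    - (ιn (suc m) + ιn (suc n))    ≈⟨ -‿anti-homo-+ _ _ ⟩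
    - ιn (suc n) + - ιn (suc m)    ≈⟨ +-comm _ _ ⟩
    - ιn (suc m) + - ιn (suc n)    ∎
  +-homo -[1+ m ] (+ n) = trans (⊖-homo n (suc m)) (+-comm _ _)
  +-homo (+ m) -[1+ n ] = ⊖-homo m (suc n)
  +-homo (+ m) (+ n) = ιn-+ m n

  ℤ-rawRing : RawRing _ _
  ℤ-rawRing = record
    { Carrier = ℤ ; _≈_ = _≡_ ; _+_ = ℤ._+_ ; _*_ = ℤ._*_ ; -_ = ℤ.-_ ; 0# = + 0 ; 1# = + 1 }

  ℤ⟶R : ℤ-rawRing -Raw-AlmostCommutative⟶ fromCommutativeRing R
  ℤ⟶R = record
    { ⟦_⟧ = ⟦_⟧ℤ ; +-homo = +-homo ; *-homo = *-homo ; -‿homo = neg-homo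
    ; 0-homo = refl ; 1-homo = refl }

  coefficient-test : ∀ i j → Maybe (⟦ i ⟧ℤ ≈ ⟦ j ⟧ℤ)
  coefficient-test i j with i ℤ.≟ j
  ... | yes P.refl = just refl
  ... | no _ = nothing

  open import Algebra.Solver.Ring ℤ-rawRing (fromCommutativeRing R) ℤ⟶R coefficient-test public

module Theory {c ℓ} (F : CharZeroField c ℓ) where
  open import Data.Nat as ℕ using (zero; _∸_; _<_; z≤n; _!)
  open import Data.List using ([]; _∷_; length)
  import Data.Bool as Bool
  open Bool using (true; false)
  import Data.Nat.Properties as ℕP
  open import Data.Empty using (⊥-elim)
  open import Data.Sum using (inj₁; inj₂)
  open import Data.Product using (_,_)
  open import Relation.Binary.PropositionalEquality as P using (_≡_)
  open import Relation.Binary.Definitions using (tri<; tri≈; tri>)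
  open import Relation.Nullary using (yes; no)
  open import Data.Nat.Combinatorics using (_C_)
  import Data.Integer as ℤ
  open CharZeroField F
  open FPS F public
  open import Algebra.Properties.Ring ring using (-0#≈0#; -‿distribʳ-*; -‿anti-homo-+; -‿involutive)
  open IntegerRingSolver commutativeRing using (solve; _:+_; _:*_; _:-_; :-_; _:=_; con)

  module ≈-Reasoning where
    open import Relation.Binary.Reasoning.Setoid setoid public

  cancel-zero : ∀ {x y} → ¬ (x ≈ 0#) → x * y ≈ 0# → y ≈ 0#
  cancel-zero {x} {y} x≉0 xy≈0 = begin
    y                   ≈⟨ sym (*-identityˡ _) ⟩
    1# * y              ≈⟨ *-congʳ (sym (trans (*-comm _ _) (⁻¹-inverse x x≉0))) ⟩
    ((x ⁻¹) * x) * y    ≈⟨ *-assoc _ _ _ ⟩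
    (x ⁻¹) * (x * y)    ≈⟨ *-congˡ xy≈0 ⟩
    (x ⁻¹) * 0#         ≈⟨ zeroʳ _ ⟩
    0#                  ∎
    where open ≈-Reasoning

  cancelˡ : ∀ {x y z} → ¬ (x ≈ 0#) → x * y ≈ x * z → y ≈ z
  cancelˡ {x} {y} {z} x≉0 xy≈xz = begin
    y              ≈⟨ sym (+-identityʳ _) ⟩
    y + 0#         ≈⟨ +-congˡ (sym (cancel-zero x≉0 x[z-y]≈0)) ⟩
    y + (z - y)    ≈⟨ solve 2 (λ y z → y :+ (z :- y) := z) refl y z ⟩
    z              ∎
    where
    open ≈-Reasoning
    x[z-y]≈0 : x * (z - y) ≈ 0#
    x[z-y]≈0 = trans (solve 3 (λ x y z → x :* (z :- y) := x :* z :- x :* y) refl x y z)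
                     (trans (+-congʳ (sym xy≈xz)) (-‿inverseʳ _))

  nonzero-* : ∀ {x y} → ¬ (x ≈ 0#) → ¬ (y ≈ 0#) → ¬ (x * y ≈ 0#)
  nonzero-* x≉0 y≉0 xy≈0 = y≉0 (cancel-zero x≉0 xy≈0)

  inverse-unique : ∀ {x y} → ¬ (x ≈ 0#) → x * y ≈ 1# → y ≈ x ⁻¹
  inverse-unique x≉0 xy≈1 = cancelˡ x≉0 (trans xy≈1 (sym (⁻¹-inverse _ x≉0)))

  1⁻¹≈1 : 1# ⁻¹ ≈ 1#
  1⁻¹≈1 = sym (inverse-unique (λ 1≈0 → char0 0 (trans (+-identityʳ _) 1≈0)) (*-identityˡ 1#))

  ι-+ : ∀ m n → ι (m ℕ.+ n) ≈ ι m + ι n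
  ι-+ zero n = sym (+-identityˡ _)
  ι-+ (suc m) n = trans (+-congˡ (ι-+ m n)) (sym (+-assoc _ _ _))

  ι-* : ∀ m n → ι (m ℕ.* n) ≈ ι m * ι n
  ι-* zero n = sym (zeroˡ _)
  ι-* (suc m) n = begin
    ι (n ℕ.+ m ℕ.* n)       ≈⟨ ι-+ n (m ℕ.* n) ⟩
    ι n + ι (m ℕ.* n)       ≈⟨ +-cong (sym (*-identityˡ _)) (ι-* m n) ⟩
    1# * ι n + ι m * ι n    ≈⟨ sym (distribʳ _ _ _) ⟩
    (1# + ι m) * ι n        ∎
    where open ≈-Reasoning

  fact≈ι! : ∀ k → fact k ≈ ι (k !)
  fact≈ι! zero = sym (+-identityʳ _)
  fact≈ι! (suc k) = trans (*-congˡ (fact≈ι! k)) (sym (ι-* (suc k) (k !)))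

  fact-nonzero : ∀ n → ¬ (fact n ≈ 0#)
  fact-nonzero zero 1≈0 = char0 0 (trans (+-identityʳ _) 1≈0)
  fact-nonzero (suc n) = nonzero-* (char0 n) (fact-nonzero n)

  fact⁻¹-step : ∀ n → ι (suc n) * fact (suc n) ⁻¹ ≈ fact n ⁻¹
  fact⁻¹-step n = inverse-unique (fact-nonzero n)
    (trans (sym (*-assoc _ _ _)) (trans (*-congʳ (*-comm _ _)) (⁻¹-inverse _ (fact-nonzero (suc n)))))

  binomial-factorials : ∀ {m l} → l ≤ m → ι (m C l) * (fact l * fact (m ∸ l)) ≈ fact m
  binomial-factorials {m} {l} l≤m = begin
    ι (m C l) * (fact l * fact (m ∸ l))          ≈⟨ *-congˡ (*-cong (fact≈ι! l) (fact≈ι! (m ∸ l))) ⟩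
    ι (m C l) * (ι (l !) * ι ((m ∸ l) !))        ≈⟨ *-congˡ (sym (ι-* (l !) ((m ∸ l) !))) ⟩
    ι (m C l) * ι (l ! ℕ.* (m ∸ l) !)            ≈⟨ sym (ι-* (m C l) _) ⟩
    ι ((m C l) ℕ.* (l ! ℕ.* (m ∸ l) !))          ≈⟨ reflexive (P.cong ι (binomial-ℕ l≤m)) ⟩
    ι (m !)                                      ≈⟨ sym (fact≈ι! m) ⟩
    fact m                                       ∎
    where
    open ≈-Reasoning
    open import Data.Nat.Combinatorics using (nCk≡n!/k![n-k]!; k![n∸k]!∣n!)
    open import Data.Nat.DivMod using (m/n*n≡m)
    binomial-ℕ : ∀ {n k} → k ≤ n → (n C k) ℕ.* (k ! ℕ.* (n ∸ k) !) ≡ n !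
    binomial-ℕ {n} {k} k≤n =
      P.trans (P.cong (ℕ._* (k ! ℕ.* (n ∸ k) !)) (nCk≡n!/k![n-k]! k≤n)) (m/n*n≡m (k![n∸k]!∣n! k≤n))
      where instance _ = k ℕP.!* (n ∸ k) !≢0

  Σ-cong : ∀ n {a b : ℕ → Carrier} → (∀ i → a i ≈ b i) → sumTo n a ≈ sumTo n b
  Σ-cong zero e = refl
  Σ-cong (suc n) e = +-cong (Σ-cong n e) (e n)

  Σ-cong< : ∀ n {a b : ℕ → Carrier} → (∀ i → i < n → a i ≈ b i) → sumTo n a ≈ sumTo n b
  Σ-cong< zero e = refl
  Σ-cong< (suc n) e = +-cong (Σ-cong< n (λ i i<n → e i (ℕP.m<n⇒m<1+n i<n))) (e n ℕP.≤-refl)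

  Σ-zero : ∀ n {a : ℕ → Carrier} → (∀ i → i < n → a i ≈ 0#) → sumTo n a ≈ 0#
  Σ-zero zero e = refl
  Σ-zero (suc n) e = trans (+-cong (Σ-zero n (λ i i<n → e i (ℕP.m<n⇒m<1+n i<n))) (e n ℕP.≤-refl)) (+-identityˡ _)

  Σ-+ : ∀ n (a b : ℕ → Carrier) → sumTo n (λ i → a i + b i) ≈ sumTo n a + sumTo n b
  Σ-+ zero a b = sym (+-identityˡ _)
  Σ-+ (suc n) a b = trans (+-congʳ (Σ-+ n a b))
    (solve 4 (λ x y z w → (x :+ y) :+ (z :+ w) := (x :+ z) :+ (y :+ w)) refl _ _ _ _)

  Σ-neg : ∀ n (a : ℕ → Carrier) → - sumTo n a ≈ sumTo n (λ i → - a i)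
  Σ-neg zero a = -0#≈0#
  Σ-neg (suc n) a = trans (-‿anti-homo-+ _ _) (trans (+-comm _ _) (+-congʳ (Σ-neg n a)))

  Σ-*ˡ : ∀ n r (a : ℕ → Carrier) → r * sumTo n a ≈ sumTo n (λ i → r * a i)
  Σ-*ˡ zero r a = zeroʳ r
  Σ-*ˡ (suc n) r a = trans (distribˡ _ _ _) (+-congʳ (Σ-*ˡ n r a))

  Σ-*ʳ : ∀ n r (a : ℕ → Carrier) → sumTo n a * r ≈ sumTo n (λ i → a i * r)
  Σ-*ʳ n r a = trans (*-comm _ _) (trans (Σ-*ˡ n r a) (Σ-cong n (λ i → *-comm _ _)))

  Σ-first : ∀ n (a : ℕ → Carrier) → sumTo (suc n) a ≈ a 0 + sumTo n (λ i → a (suc i))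
  Σ-first zero a = trans (+-identityˡ _) (sym (+-identityʳ _))
  Σ-first (suc n) a = trans (+-congʳ (Σ-first n a)) (+-assoc _ _ _)

  Σ-reverse : ∀ n (a : ℕ → Carrier) → sumTo (suc n) a ≈ sumTo (suc n) (λ i → a (n ∸ i))
  Σ-reverse zero a = refl
  Σ-reverse (suc n) a = sym (begin
    sumTo (suc (suc n)) (λ i → a (suc n ∸ i))        ≈⟨ Σ-first (suc n) _ ⟩
    a (suc n) + sumTo (suc n) (λ i → a (n ∸ i))      ≈⟨ +-congˡ (sym (Σ-reverse n a)) ⟩
    a (suc n) + sumTo (suc n) a                      ≈⟨ +-comm _ _ ⟩
    sumTo (suc n) a + a (suc n)                      ∎)
    where open ≈-Reasoning

  Σ-swap : ∀ m n (a : ℕ → ℕ → Carrier) →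
           sumTo m (λ i → sumTo n (λ j → a i j)) ≈ sumTo n (λ j → sumTo m (λ i → a i j))
  Σ-swap zero n a = sym (Σ-zero n (λ _ _ → refl))
  Σ-swap (suc m) n a = trans (+-congʳ (Σ-swap m n a)) (sym (Σ-+ n _ _))

  Σ-truncate : ∀ m n (a : ℕ → Carrier) → m ≤ n → (∀ i → m ≤ i → a i ≈ 0#) → sumTo n a ≈ sumTo m a
  Σ-truncate m n a m≤n vanish =
    trans (reflexive (P.cong (λ k → sumTo k a) (P.sym (ℕP.m∸n+n≡m m≤n)))) (extend (n ∸ m))
    where
    extend : ∀ k → sumTo (k ℕ.+ m) a ≈ sumTo m a
    extend zero = refl
    extend (suc k) = trans (+-cong (extend k) (vanish (k ℕ.+ m) (ℕP.m≤n+m m k))) (+-identityʳ _)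

  Σ-single : ∀ M k (a : ℕ → Carrier) → k < M → (∀ i → i < M → ¬ i ≡ k → a i ≈ 0#) → sumTo M a ≈ a k
  Σ-single (suc M) k a k<1+M others with ℕP.<-cmp k M
  ... | tri< k<M _ _ = trans (+-cong (Σ-single M k a k<M (λ i i<M → others i (ℕP.m<n⇒m<1+n i<M)))
                                     (others M ℕP.≤-refl (λ M≡k → ℕP.<-irrefl (P.sym M≡k) k<M)))
                             (+-identityʳ _)
  ... | tri≈ _ P.refl _ = trans (+-congʳ (Σ-zero M (λ i i<M → others i (ℕP.m<n⇒m<1+n i<M) (λ i≡M → ℕP.<-irrefl i≡M i<M))))
                                (+-identityˡ _)
  ... | tri> _ _ M<k = ⊥-elim (ℕP.<-irrefl P.refl (ℕP.<-≤-trans M<k (ℕP.≤-pred k<1+M)))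

  -- The commutative ring of formal power series.  Equality is coefficientwise;
  -- wrapping it in a record keeps the two series recoverable by inference.

  infix 4 _≐_
  record _≐_ (a b : Series) : Set ℓ where
    constructor coefficientwise
    field at : ∀ n → a n ≈ b n
  open _≐_ public

  T : Series
  T = mulT (const 1#)

  negS : Series → Series
  negS a n = - a n

  shift : Series → Series
  shift a i = a (suc i)

  const-0-at : ∀ n → const 0# n ≈ 0#
  const-0-at zero = refl
  const-0-at (suc n) = refl

  ⊛-at-0 : ∀ a b → (a ⊛ b) 0 ≈ a 0 * b 0
  ⊛-at-0 a b = +-identityˡ _

  ⊛-at-suc : ∀ a b n → (a ⊛ b) (suc n) ≈ a 0 * b (suc n) + (shift a ⊛ b) n
  ⊛-at-suc a b n = Σ-first (suc n) _

  ⊛-cong : ∀ {a a' b b'} → a ≐ a' → b ≐ b' → a ⊛ b ≐ a' ⊛ b'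
  ⊛-cong ea eb = coefficientwise λ n → Σ-cong (suc n) (λ i → *-cong (at ea i) (at eb (n ∸ i)))

  ⊛-comm : ∀ a b → a ⊛ b ≐ b ⊛ a
  ⊛-comm a b = coefficientwise λ n → trans (Σ-reverse n _)
    (Σ-cong< (suc n) (λ i i≤n → trans (*-comm _ _)
      (*-congʳ (reflexive (P.cong b (ℕP.m∸[m∸n]≡n (ℕP.≤-pred i≤n)))))))

  ⊛-distribʳ : ∀ a b d → (a ⊕ b) ⊛ d ≐ (a ⊛ d) ⊕ (b ⊛ d)
  ⊛-distribʳ a b d = coefficientwise λ n → trans (Σ-cong (suc n) (λ i → distribʳ _ _ _)) (Σ-+ (suc n) _ _)

  ⊛-distribˡ : ∀ a b d → d ⊛ (a ⊕ b) ≐ (d ⊛ a) ⊕ (d ⊛ b)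
  ⊛-distribˡ a b d = coefficientwise λ n → trans (Σ-cong (suc n) (λ i → distribˡ _ _ _)) (Σ-+ (suc n) _ _)

  ⊛-scaleˡ : ∀ r a b → scale r a ⊛ b ≐ scale r (a ⊛ b)
  ⊛-scaleˡ r a b = coefficientwise λ n → trans (Σ-cong (suc n) (λ i → *-assoc _ _ _)) (sym (Σ-*ˡ (suc n) r _))

  ⊛-identityˡ : ∀ a → const 1# ⊛ a ≐ a
  ⊛-identityˡ a = coefficientwise λ n →
    trans (Σ-first n _) (trans (+-cong (*-identityˡ _) (Σ-zero n (λ i _ → zeroˡ _))) (+-identityʳ _))

  ⊛-assoc-at : ∀ n a b d → ((a ⊛ b) ⊛ d) n ≈ (a ⊛ (b ⊛ d)) n
  ⊛-assoc-at zero a b d = begin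
    ((a ⊛ b) ⊛ d) 0     ≈⟨ trans (⊛-at-0 (a ⊛ b) d) (*-congʳ (⊛-at-0 a b)) ⟩
    (a 0 * b 0) * d 0   ≈⟨ *-assoc _ _ _ ⟩
    a 0 * (b 0 * d 0)   ≈⟨ sym (trans (⊛-at-0 a (b ⊛ d)) (*-congˡ (⊛-at-0 b d))) ⟩
    (a ⊛ (b ⊛ d)) 0     ∎
    where open ≈-Reasoning
  ⊛-assoc-at (suc n) a b d = begin
    ((a ⊛ b) ⊛ d) (suc n)
      ≈⟨ ⊛-at-suc (a ⊛ b) d n ⟩
    (a ⊛ b) 0 * d (suc n) + (shift (a ⊛ b) ⊛ d) n
      ≈⟨ +-cong (*-congʳ (⊛-at-0 a b)) (at (⊛-cong {b = d} (coefficientwise (⊛-at-suc a b)) (coefficientwise λ _ → refl)) n) ⟩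
    (a 0 * b 0) * d (suc n) + ((scale (a 0) (shift b) ⊕ (shift a ⊛ b)) ⊛ d) n
      ≈⟨ +-congˡ (trans (at (⊛-distribʳ (scale (a 0) (shift b)) (shift a ⊛ b) d) n)
                        (+-cong (at (⊛-scaleˡ (a 0) (shift b) d) n) (⊛-assoc-at n (shift a) b d))) ⟩
    (a 0 * b 0) * d (suc n) + (a 0 * (shift b ⊛ d) n + (shift a ⊛ (b ⊛ d)) n)
      ≈⟨ solve 5 (λ x y z u v → (x :* y) :* z :+ (x :* u :+ v) := x :* (y :* z :+ u) :+ v) refl _ _ _ _ _ ⟩
    a 0 * (b 0 * d (suc n) + (shift b ⊛ d) n) + (shift a ⊛ (b ⊛ d)) n
      ≈⟨ +-congʳ (*-congˡ (sym (⊛-at-suc b d n))) ⟩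
    a 0 * (b ⊛ d) (suc n) + (shift a ⊛ (b ⊛ d)) n
      ≈⟨ sym (⊛-at-suc a (b ⊛ d) n) ⟩
    (a ⊛ (b ⊛ d)) (suc n) ∎
    where open ≈-Reasoning

  seriesRing : CommutativeRing c ℓ
  seriesRing = record
    { Carrier = Series ; _≈_ = _≐_ ; _+_ = _⊕_ ; _*_ = _⊛_ ; -_ = negS ; 0# = const 0# ; 1# = const 1#
    ; isCommutativeRing = record
      { isRing = record
        { +-isAbelianGroup = record
          { isGroup = record
            { isMonoid = record
              { isSemigroup = record
                { isMagma = record
                  { isEquivalence = record
                    { refl = coefficientwise λ n → refl
                    ; sym = λ e → coefficientwise λ n → sym (at e n)
                    ; trans = λ e f → coefficientwise λ n → trans (at e n) (at f n) }
                  ; ∙-cong = λ e f → coefficientwise λ n → +-cong (at e n) (at f n) }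
                ; assoc = λ a b d → coefficientwise λ n → +-assoc _ _ _ }
              ; identity = (λ a → coefficientwise λ { zero → +-identityˡ _ ; (suc n) → +-identityˡ _ })
                         , (λ a → coefficientwise λ { zero → +-identityʳ _ ; (suc n) → +-identityʳ _ }) }
            ; inverse = (λ a → coefficientwise λ { zero → -‿inverseˡ _ ; (suc n) → -‿inverseˡ _ })
                      , (λ a → coefficientwise λ { zero → -‿inverseʳ _ ; (suc n) → -‿inverseʳ _ })
            ; ⁻¹-cong = λ e → coefficientwise λ n → -‿cong (at e n) }
          ; comm = λ a b → coefficientwise λ n → +-comm _ _ }
        ; *-cong = ⊛-cong
        ; *-assoc = λ a b d → coefficientwise λ n → ⊛-assoc-at n a b d
        ; *-identity = ⊛-identityˡ , (λ a → coefficientwise λ n → trans (at (⊛-comm a _) n) (at (⊛-identityˡ a) n))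
        ; distrib = (λ d a b → ⊛-distribˡ a b d) , (λ d a b → ⊛-distribʳ a b d) }
      ; *-comm = ⊛-comm } }

  module SR = CommutativeRing seriesRing
  module SS = IntegerRingSolver seriesRing
  open SS using () renaming (solve to solveₛ)

  module ≐-Reasoning where
    open import Relation.Binary.Reasoning.Setoid SR.setoid public

  ⊕-congˡ : ∀ x {y z} → y ≐ z → x ⊕ y ≐ x ⊕ z
  ⊕-congˡ x e = SR.+-congˡ {x} e
  ⊕-congʳ : ∀ x {y z} → y ≐ z → y ⊕ x ≐ z ⊕ x
  ⊕-congʳ x e = SR.+-congʳ {x} e
  ⊛-congˡ : ∀ x {y z} → y ≐ z → x ⊛ y ≐ x ⊛ z
  ⊛-congˡ x e = SR.*-congˡ {x} e
  ⊛-congʳ : ∀ x {y z} → y ≐ z → y ⊛ x ≐ z ⊛ x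
  ⊛-congʳ x e = SR.*-congʳ {x} e

  const-cong : ∀ {x y} → x ≈ y → const x ≐ const y
  const-cong e = coefficientwise λ { zero → e ; (suc n) → refl }

  const-+ : ∀ x y → const (x + y) ≐ const x ⊕ const y
  const-+ x y = coefficientwise λ { zero → refl ; (suc n) → sym (+-identityˡ _) }

  const-neg : ∀ x → const (- x) ≐ negS (const x)
  const-neg x = coefficientwise λ { zero → refl ; (suc n) → sym -0#≈0# }

  scale≐const-⊛ : ∀ r a → scale r a ≐ const r ⊛ a
  scale≐const-⊛ r a = coefficientwise λ n →
    sym (trans (Σ-first n _) (trans (+-congˡ (Σ-zero n (λ i _ → zeroˡ _))) (+-identityʳ _)))

  const-* : ∀ x y → const (x * y) ≐ const x ⊛ const y
  const-* x y = coefficientwise λ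
    { zero → sym (⊛-at-0 (const x) (const y))
    ; (suc n) → sym (trans (sym (at (scale≐const-⊛ x (const y)) (suc n))) (zeroʳ _)) }

  powN-cong : ∀ {a b} → a ≐ b → ∀ k → powN a k ≐ powN b k
  powN-cong e zero = SR.refl
  powN-cong e (suc k) = SR.*-cong e (powN-cong e k)

  powN-⊛ : ∀ a b k → powN (a ⊛ b) k ≐ powN a k ⊛ powN b k
  powN-⊛ a b zero = SR.sym (SR.*-identityˡ (const 1#))
  powN-⊛ a b (suc k) = SR.trans (⊛-congˡ (a ⊛ b) (powN-⊛ a b k))
    (solveₛ 4 (λ a b x y → (a SS.:* b) SS.:* (x SS.:* y) SS.:= (a SS.:* x) SS.:* (b SS.:* y)) SR.refl a b (powN a k) (powN b k))

  powN-+ : ∀ a p q → powN a (p ℕ.+ q) ≐ powN a p ⊛ powN a q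
  powN-+ a zero q = SR.sym (SR.*-identityˡ (powN a q))
  powN-+ a (suc p) q = SR.trans (⊛-congˡ a (powN-+ a p q)) (SR.sym (SR.*-assoc a (powN a p) (powN a q)))

  powN-one : ∀ k → powN (const 1#) k ≐ const 1#
  powN-one zero = SR.refl
  powN-one (suc k) = SR.trans (SR.*-identityˡ (powN (const 1#) k)) (powN-one k)

  powN-at-0 : ∀ a → a 0 ≈ 1# → ∀ k → powN a k 0 ≈ 1#
  powN-at-0 a a0≈1 zero = refl
  powN-at-0 a a0≈1 (suc k) = trans (⊛-at-0 a (powN a k)) (trans (*-cong a0≈1 (powN-at-0 a a0≈1 k)) (*-identityˡ _))

  powN-order : ∀ G → G 0 ≈ 0# → ∀ k n → n < k → powN G k n ≈ 0#
  powN-order G G0≈0 (suc k) zero _ = trans (⊛-at-0 G (powN G k)) (trans (*-congʳ G0≈0) (zeroˡ _))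
  powN-order G G0≈0 (suc k) (suc m) (s≤s m<k) = begin
    (G ⊛ powN G k) (suc m)                           ≈⟨ ⊛-at-suc G (powN G k) m ⟩
    G 0 * powN G k (suc m) + (shift G ⊛ powN G k) m  ≈⟨ +-cong (trans (*-congʳ G0≈0) (zeroˡ _)) (Σ-zero (suc m) lower) ⟩
    0# + 0#                                          ≈⟨ +-identityʳ _ ⟩
    0#                                               ∎
    where
    open ≈-Reasoning
    lower : ∀ i → i < suc m → shift G i * powN G k (m ∸ i) ≈ 0#
    lower i _ = trans (*-congˡ (powN-order G G0≈0 k (m ∸ i) (ℕP.≤-trans (s≤s (ℕP.m∸n≤m m i)) m<k))) (zeroʳ _)

  mulT-⊛ : ∀ a b → mulT a ⊛ b ≐ mulT (a ⊛ b)
  mulT-⊛ a b = coefficientwise λ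
    { zero → trans (⊛-at-0 (mulT a) b) (zeroˡ _)
    ; (suc n) → trans (⊛-at-suc (mulT a) b n) (trans (+-congʳ (zeroˡ _)) (+-identityˡ _)) }

  mulT≐T⊛ : ∀ a → mulT a ≐ T ⊛ a
  mulT≐T⊛ a = SR.sym (SR.trans (mulT-⊛ (const 1#) a)
    (coefficientwise λ { zero → refl ; (suc n) → at (SR.*-identityˡ a) n }))

  T^-suc : ∀ j X → powN T (suc j) ⊛ X ≐ mulT (powN T j ⊛ X)
  T^-suc j X = SR.trans (SR.*-assoc T (powN T j) X) (SR.sym (mulT≐T⊛ (powN T j ⊛ X)))

  T^-below : ∀ j X i → i < j → (powN T j ⊛ X) i ≈ 0#
  T^-below (suc j) X zero _ = at (T^-suc j X) 0
  T^-below (suc j) X (suc i) (s≤s i<j) = trans (at (T^-suc j X) (suc i)) (T^-below j X i i<j)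

  T^-at : ∀ j X i → (powN T j ⊛ X) (j ℕ.+ i) ≈ X i
  T^-at zero X i = at (SR.*-identityˡ X) i
  T^-at (suc j) X i = trans (at (T^-suc j X) (suc (j ℕ.+ i))) (T^-at j X i)

  cancel-power : ∀ E H n → H ⊛ powN E n ≐ const 1# → ∀ A B → A ⊛ powN E n ≐ B ⊛ powN E n → A ≐ B
  cancel-power E H n HEⁿ≐1 A B AEⁿ≐BEⁿ = begin
    A                        ≈⟨ SR.sym (SR.*-identityʳ A) ⟩
    A ⊛ const 1#             ≈⟨ ⊛-congˡ A (SR.sym HEⁿ≐1) ⟩
    A ⊛ (H ⊛ powN E n)       ≈⟨ regroup A ⟩
    (A ⊛ powN E n) ⊛ H       ≈⟨ ⊛-congʳ H AEⁿ≐BEⁿ ⟩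
    (B ⊛ powN E n) ⊛ H       ≈⟨ SR.sym (regroup B) ⟩
    B ⊛ (H ⊛ powN E n)       ≈⟨ ⊛-congˡ B HEⁿ≐1 ⟩
    B ⊛ const 1#             ≈⟨ SR.*-identityʳ B ⟩
    B                        ∎
    where
    open ≐-Reasoning
    regroup : ∀ X → X ⊛ (H ⊛ powN E n) ≐ (X ⊛ powN E n) ⊛ H
    regroup X = solveₛ 3 (λ x h p → x SS.:* (h SS.:* p) SS.:= (x SS.:* p) SS.:* h) SR.refl X H (powN E n)

  D : Series → Series
  D a n = ι (suc n) * a (suc n)

  D-cong : ∀ {a b} → a ≐ b → D a ≐ D b
  D-cong e = coefficientwise λ n → *-congˡ (at e (suc n))

  D-⊕ : ∀ a b → D (a ⊕ b) ≐ D a ⊕ D b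
  D-⊕ a b = coefficientwise λ n → distribˡ _ _ _

  D-neg : ∀ a → D (negS a) ≐ negS (D a)
  D-neg a = coefficientwise λ n → sym (-‿distribʳ-* _ _)

  D-const : ∀ r → D (const r) ≐ const 0#
  D-const r = coefficientwise λ { zero → zeroʳ _ ; (suc n) → zeroʳ _ }

  D-scale : ∀ r a → D (scale r a) ≐ scale r (D a)
  D-scale r a = coefficientwise λ n → solve 3 (λ x y z → x :* (y :* z) := y :* (x :* z)) refl _ _ _

  D-T : D T ≐ const 1#
  D-T = coefficientwise λ { zero → trans (*-identityʳ _) (+-identityʳ _) ; (suc n) → zeroʳ _ }

  -- Leibniz rule: coefficientwise, (n+1) = i + (n+1-i) splits each product term
  D-⊛ : ∀ a b → D (a ⊛ b) ≐ (D a ⊛ b) ⊕ (a ⊛ D b)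
  D-⊛ a b = coefficientwise λ n → begin
    ι (suc n) * sumTo (suc (suc n)) (λ i → a i * b (suc n ∸ i))
      ≈⟨ Σ-*ˡ (suc (suc n)) _ _ ⟩
    sumTo (suc (suc n)) (λ i → ι (suc n) * (a i * b (suc n ∸ i)))
      ≈⟨ Σ-cong< (suc (suc n)) (λ i i≤1+n → split n i (ℕP.≤-pred i≤1+n)) ⟩
    sumTo (suc (suc n)) (λ i → ι i * a i * b (suc n ∸ i) + a i * (ι (suc n ∸ i) * b (suc n ∸ i)))
      ≈⟨ Σ-+ (suc (suc n)) _ _ ⟩
    sumTo (suc (suc n)) (λ i → ι i * a i * b (suc n ∸ i)) + sumTo (suc (suc n)) (λ i → a i * (ι (suc n ∸ i) * b (suc n ∸ i)))
      ≈⟨ +-cong (left n) (right n) ⟩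
    (D a ⊛ b) n + (a ⊛ D b) n ∎
    where
    open ≈-Reasoning
    split : ∀ n i → i ≤ suc n → ι (suc n) * (a i * b (suc n ∸ i)) ≈ ι i * a i * b (suc n ∸ i) + a i * (ι (suc n ∸ i) * b (suc n ∸ i))
    split n i i≤1+n = trans (*-congʳ (trans (reflexive (P.cong ι (P.sym (ℕP.m+[n∸m]≡n i≤1+n)))) (ι-+ i (suc n ∸ i))))
      (solve 4 (λ p q x y → (p :+ q) :* (x :* y) := p :* x :* y :+ x :* (q :* y)) refl _ _ _ _)
    -- the i = 0 term of the first sum vanishes
    left : ∀ n → sumTo (suc (suc n)) (λ i → ι i * a i * b (suc n ∸ i)) ≈ (D a ⊛ b) n
    left n = trans (Σ-first (suc n) _) (trans (+-congʳ (trans (*-assoc _ _ _) (zeroˡ _))) (+-identityˡ _))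
    -- the i = n+1 term of the second sum vanishes
    right : ∀ n → sumTo (suc (suc n)) (λ i → a i * (ι (suc n ∸ i) * b (suc n ∸ i))) ≈ (a ⊛ D b) n
    right n = begin
      sumTo (suc n) (λ i → a i * (ι (suc n ∸ i) * b (suc n ∸ i))) + a (suc n) * (ι (n ∸ n) * b (n ∸ n))
        ≈⟨ +-congˡ (trans (*-congˡ (trans (*-congʳ (reflexive (P.cong ι (ℕP.n∸n≡0 n)))) (zeroˡ _))) (zeroʳ _)) ⟩
      sumTo (suc n) (λ i → a i * (ι (suc n ∸ i) * b (suc n ∸ i))) + 0#
        ≈⟨ +-identityʳ _ ⟩
      sumTo (suc n) (λ i → a i * (ι (suc n ∸ i) * b (suc n ∸ i)))
        ≈⟨ Σ-cong< (suc n) (λ i i≤n → reflexive (P.cong (λ k → a i * (ι k * b k)) (ℕP.+-∸-assoc 1 (ℕP.≤-pred i≤n)))) ⟩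
      (a ⊛ D b) n ∎

  D-powN : ∀ a k → D (powN a (suc k)) ≐ const (ι (suc k)) ⊛ (powN a k ⊛ D a)
  D-powN a zero = begin
    D (a ⊛ const 1#)                           ≈⟨ D-⊛ a (const 1#) ⟩
    (D a ⊛ const 1#) ⊕ (a ⊛ D (const 1#))      ≈⟨ ⊕-congˡ (D a ⊛ const 1#) (⊛-congˡ a (D-const 1#)) ⟩
    (D a ⊛ const 1#) ⊕ (a ⊛ const 0#)          ≈⟨ solveₛ 2 (λ x y → (x SS.:* SS.con (ℤ.+ 1)) SS.:+ (y SS.:* SS.con (ℤ.+ 0))
                                                     SS.:= SS.con (ℤ.+ 1) SS.:* (SS.con (ℤ.+ 1) SS.:* x)) SR.refl (D a) a ⟩
    const 1# ⊛ (const 1# ⊛ D a)                ≈⟨ ⊛-congʳ (const 1# ⊛ D a) (const-cong (sym (+-identityʳ 1#))) ⟩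
    const (ι 1) ⊛ (const 1# ⊛ D a)             ∎
    where open ≐-Reasoning
  D-powN a (suc k) = begin
    D (a ⊛ powN a (suc k))
      ≈⟨ D-⊛ a (powN a (suc k)) ⟩
    (D a ⊛ powN a (suc k)) ⊕ (a ⊛ D (powN a (suc k)))
      ≈⟨ ⊕-congˡ (D a ⊛ powN a (suc k)) (⊛-congˡ a (D-powN a k)) ⟩
    (D a ⊛ (a ⊛ powN a k)) ⊕ (a ⊛ (const (ι (suc k)) ⊛ (powN a k ⊛ D a)))
      ≈⟨ solveₛ 4 (λ d x p c → (d SS.:* (x SS.:* p)) SS.:+ (x SS.:* (c SS.:* (p SS.:* d)))
                      SS.:= (SS.con (ℤ.+ 1) SS.:+ c) SS.:* ((x SS.:* p) SS.:* d)) SR.refl (D a) a (powN a k) (const (ι (suc k))) ⟩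
    (const 1# ⊕ const (ι (suc k))) ⊛ ((a ⊛ powN a k) ⊛ D a)
      ≈⟨ ⊛-congʳ ((a ⊛ powN a k) ⊛ D a) (SR.sym (const-+ 1# (ι (suc k)))) ⟩
    const (ι (suc (suc k))) ⊛ (powN a (suc k) ⊛ D a) ∎
    where open ≐-Reasoning

  -- coefficient n of the equation determines W (n+1) from W 0 … W n
  ode-step : ∀ h b W → h 0 ≈ 1# → h ⊛ D W ≐ b ⊛ W →
             ∀ n → (∀ i → i ≤ n → W i ≈ 0#) → W (suc n) ≈ 0#
  ode-step h b W h0≈1 hW'≐bW n below =
    cancel-zero (nonzero-* h0≉0 (char0 n)) (trans (*-assoc _ _ _) (begin
      h 0 * D W n                                                  ≈⟨ sym (+-identityʳ _) ⟩
      h 0 * D W n + 0#                                             ≈⟨ +-congˡ (sym later-terms) ⟩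
      h 0 * D W n + sumTo n (λ i → h (suc i) * D W (n ∸ suc i))    ≈⟨ sym (Σ-first n _) ⟩
      (h ⊛ D W) n                                                  ≈⟨ at hW'≐bW n ⟩
      (b ⊛ W) n                                                    ≈⟨ Σ-zero (suc n) (λ i _ → trans (*-congˡ (below (n ∸ i) (ℕP.m∸n≤m n i))) (zeroʳ _)) ⟩
      0#                                                           ∎))
    where
    open ≈-Reasoning
    h0≉0 : ¬ (h 0 ≈ 0#)
    h0≉0 h0≈0 = fact-nonzero 0 (trans (sym h0≈1) h0≈0)
    later-terms : sumTo n (λ i → h (suc i) * D W (n ∸ suc i)) ≈ 0#
    later-terms = Σ-zero n λ i i<n → trans (*-congˡ (trans (*-congˡ (below (suc (n ∸ suc i))
      (P.subst (_≤ n) (ℕP.+-∸-assoc 1 i<n) (ℕP.m∸n≤m n i)))) (zeroʳ _))) (zeroʳ _)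

  ode-zero : ∀ h b W → h 0 ≈ 1# → h ⊛ D W ≐ b ⊛ W → W 0 ≈ 0# → W ≐ const 0#
  ode-zero h b W h0≈1 hW'≐bW W0≈0 = coefficientwise λ n → trans (vanish n n ℕP.≤-refl) (sym (const-0-at n))
    where
    vanish : ∀ n i → i ≤ n → W i ≈ 0#
    vanish zero i z≤n = W0≈0
    vanish (suc n) i i≤1+n with ℕP.m≤n⇒m<n∨m≡n i≤1+n
    ... | inj₁ i<1+n = vanish n i (ℕP.≤-pred i<1+n)
    ... | inj₂ P.refl = ode-step h b W h0≈1 hW'≐bW n (vanish n)

  ode-unique : ∀ h b Y Z → h 0 ≈ 1# → h ⊛ D Y ≐ b ⊛ Y → h ⊛ D Z ≐ b ⊛ Z → Y 0 ≈ Z 0 → Y ≐ Z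
  ode-unique h b Y Z h0≈1 eqY eqZ Y0≈Z0 = begin
    Y                     ≈⟨ solveₛ 2 (λ y z → y SS.:= (y SS.:- z) SS.:+ z) SR.refl Y Z ⟩
    (Y ⊕ negS Z) ⊕ Z      ≈⟨ ⊕-congʳ Z (ode-zero h b (Y ⊕ negS Z) h0≈1 eqY-Z (trans (+-congˡ (-‿cong (sym Y0≈Z0))) (-‿inverseʳ _))) ⟩
    const 0# ⊕ Z          ≈⟨ SR.+-identityˡ Z ⟩
    Z                     ∎
    where
    open ≐-Reasoning
    eqY-Z : h ⊛ D (Y ⊕ negS Z) ≐ b ⊛ (Y ⊕ negS Z)
    eqY-Z = begin
      h ⊛ D (Y ⊕ negS Z)           ≈⟨ ⊛-congˡ h (SR.trans (D-⊕ Y (negS Z)) (⊕-congˡ (D Y) (D-neg Z))) ⟩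
      h ⊛ (D Y ⊕ negS (D Z))       ≈⟨ SR.distribˡ h (D Y) (negS (D Z)) ⟩
      (h ⊛ D Y) ⊕ (h ⊛ negS (D Z)) ≈⟨ ⊕-congˡ (h ⊛ D Y) (SR.sym (negʳ h (D Z))) ⟩
      (h ⊛ D Y) ⊕ negS (h ⊛ D Z)   ≈⟨ SR.+-cong eqY (SR.-‿cong eqZ) ⟩
      (b ⊛ Y) ⊕ negS (b ⊛ Z)       ≈⟨ solveₛ 3 (λ b y z → b SS.:* y SS.:- b SS.:* z SS.:= b SS.:* (y SS.:- z)) SR.refl b Y Z ⟩
      b ⊛ (Y ⊕ negS Z)             ∎
      where open import Algebra.Properties.Ring SR.ring using () renaming (-‿distribʳ-* to negʳ)

  ode-unique-one : ∀ h Y b → h 0 ≈ 1# → b ≐ const 0# → h ⊛ D Y ≐ b ⊛ Y → Y 0 ≈ 1# → Y ≐ const 1#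
  ode-unique-one h Y b h0≈1 b≐0 eqY Y0≈1 = ode-unique h (const 0#) Y (const 1#) h0≈1 (SR.trans eqY (⊛-congʳ Y b≐0)) eq1 Y0≈1
    where
    eq1 : h ⊛ D (const 1#) ≐ const 0# ⊛ const 1#
    eq1 = SR.trans (⊛-congˡ h (D-const 1#))
      (solveₛ 1 (λ h → h SS.:* SS.con (ℤ.+ 0) SS.:= SS.con (ℤ.+ 0) SS.:* SS.con (ℤ.+ 1)) SR.refl h)

  ode-⊛ : ∀ h X Y b₁ b₂ → h ⊛ D X ≐ b₁ ⊛ X → h ⊛ D Y ≐ b₂ ⊛ Y → h ⊛ D (X ⊛ Y) ≐ (b₁ ⊕ b₂) ⊛ (X ⊛ Y)
  ode-⊛ h X Y b₁ b₂ eqX eqY = begin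
    h ⊛ D (X ⊛ Y)                        ≈⟨ ⊛-congˡ h (D-⊛ X Y) ⟩
    h ⊛ ((D X ⊛ Y) ⊕ (X ⊛ D Y))          ≈⟨ solveₛ 5 (λ h dx y x dy → h SS.:* ((dx SS.:* y) SS.:+ (x SS.:* dy))
                                              SS.:= (h SS.:* dx) SS.:* y SS.:+ x SS.:* (h SS.:* dy)) SR.refl h (D X) Y X (D Y) ⟩
    ((h ⊛ D X) ⊛ Y) ⊕ (X ⊛ (h ⊛ D Y))    ≈⟨ SR.+-cong (⊛-congʳ Y eqX) (⊛-congˡ X eqY) ⟩
    ((b₁ ⊛ X) ⊛ Y) ⊕ (X ⊛ (b₂ ⊛ Y))      ≈⟨ solveₛ 4 (λ b₁ b₂ x y → (b₁ SS.:* x) SS.:* y SS.:+ x SS.:* (b₂ SS.:* y)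
                                              SS.:= (b₁ SS.:+ b₂) SS.:* (x SS.:* y)) SR.refl b₁ b₂ X Y ⟩
    (b₁ ⊕ b₂) ⊛ (X ⊛ Y)                  ∎
    where open ≐-Reasoning

  ode-powN : ∀ h X b → h ⊛ D X ≐ b ⊛ X → ∀ k → h ⊛ D (powN X k) ≐ (const (ι k) ⊛ b) ⊛ powN X k
  ode-powN h X b eqX zero = begin
    h ⊛ D (const 1#)                ≈⟨ ⊛-congˡ h (D-const 1#) ⟩
    h ⊛ const 0#                    ≈⟨ solveₛ 3 (λ h b x → h SS.:* SS.con (ℤ.+ 0) SS.:= (SS.con (ℤ.+ 0) SS.:* b) SS.:* x) SR.refl h b (const 1#) ⟩
    (const 0# ⊛ b) ⊛ const 1#       ∎
    where open ≐-Reasoning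
  ode-powN h X b eqX (suc k) = begin
    h ⊛ D (X ⊛ powN X k)                              ≈⟨ ode-⊛ h X (powN X k) b (const (ι k) ⊛ b) eqX (ode-powN h X b eqX k) ⟩
    (b ⊕ (const (ι k) ⊛ b)) ⊛ (X ⊛ powN X k)          ≈⟨ solveₛ 3 (λ b i p → (b SS.:+ i SS.:* b) SS.:* p
                                                           SS.:= ((SS.con (ℤ.+ 1) SS.:+ i) SS.:* b) SS.:* p) SR.refl b (const (ι k)) (X ⊛ powN X k) ⟩
    ((const 1# ⊕ const (ι k)) ⊛ b) ⊛ (X ⊛ powN X k)   ≈⟨ ⊛-congʳ (X ⊛ powN X k) (⊛-congʳ b (SR.sym (const-+ 1# (ι k)))) ⟩
    (const (ι (suc k)) ⊛ b) ⊛ (X ⊛ powN X k)          ∎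
    where open ≐-Reasoning

  -- since G^k has order ≥ k, the defining sum may be extended to any bound M > n
  compose-extend : ∀ A G → G 0 ≈ 0# → ∀ n M → n < M → compose A G n ≈ sumTo M (λ k → A k * powN G k n)
  compose-extend A G G0≈0 n M n<M = sym (Σ-truncate (suc n) M _ n<M
    (λ k n<k → trans (*-congˡ (powN-order G G0≈0 k n n<k)) (zeroʳ _)))

  compose-at-0 : ∀ A G → compose A G 0 ≈ A 0
  compose-at-0 A G = trans (+-identityˡ _) (*-identityʳ _)

  compose-congˡ : ∀ {A B} G → A ≐ B → compose A G ≐ compose B G
  compose-congˡ G e = coefficientwise λ n → Σ-cong (suc n) (λ k → *-congʳ (at e k))

  chain-rule : ∀ A G → G 0 ≈ 0# → D (compose A G) ≐ compose (D A) G ⊛ D G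
  chain-rule A G G0≈0 = coefficientwise λ n → begin
    ι (suc n) * compose A G (suc n)
      ≈⟨ Σ-*ˡ (suc (suc n)) _ _ ⟩
    sumTo (suc (suc n)) (λ k → ι (suc n) * (A k * powN G k (suc n)))
      ≈⟨ Σ-cong (suc (suc n)) (λ k → solve 3 (λ x y z → x :* (y :* z) := y :* (x :* z)) refl _ _ _) ⟩
    sumTo (suc (suc n)) (λ k → A k * D (powN G k) n)
      ≈⟨ Σ-first (suc n) _ ⟩
    A 0 * D (const 1#) n + sumTo (suc n) (λ k → A (suc k) * D (powN G (suc k)) n)
      ≈⟨ +-cong (trans (*-congˡ (trans (at (D-const 1#) n) (const-0-at n))) (zeroʳ _))
                (Σ-cong (suc n) (λ k → *-congˡ (trans (at (D-powN G k) n) (sym (at (scale≐const-⊛ (ι (suc k)) (powN G k ⊛ D G)) n))))) ⟩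
    0# + sumTo (suc n) (λ k → A (suc k) * (ι (suc k) * (powN G k ⊛ D G) n))
      ≈⟨ trans (+-identityˡ _) (Σ-cong (suc n) (λ k → solve 3 (λ x y z → x :* (y :* z) := (y :* x) :* z) refl _ _ _)) ⟩
    sumTo (suc n) (λ k → D A k * sumTo (suc n) (λ i → powN G k i * D G (n ∸ i)))
      ≈⟨ Σ-cong (suc n) (λ k → Σ-*ˡ (suc n) _ _) ⟩
    sumTo (suc n) (λ k → sumTo (suc n) (λ i → D A k * (powN G k i * D G (n ∸ i))))
      ≈⟨ Σ-swap (suc n) (suc n) _ ⟩
    sumTo (suc n) (λ i → sumTo (suc n) (λ k → D A k * (powN G k i * D G (n ∸ i))))
      ≈⟨ Σ-cong (suc n) (λ i → trans (Σ-cong (suc n) (λ k → sym (*-assoc _ _ _))) (sym (Σ-*ʳ (suc n) _ _))) ⟩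
    sumTo (suc n) (λ i → sumTo (suc n) (λ k → D A k * powN G k i) * D G (n ∸ i))
      ≈⟨ Σ-cong< (suc n) (λ i i≤n → *-congʳ (sym (compose-extend (D A) G G0≈0 i (suc n) i≤n))) ⟩
    (compose (D A) G ⊛ D G) n ∎
    where open ≈-Reasoning

  exp-at-0 : ∀ a → expS a 0 ≈ 1#
  exp-at-0 a = trans (*-identityˡ _) 1⁻¹≈1

  D-exp : ∀ a → D (expS a) ≐ scale a (expS a)
  D-exp a = coefficientwise λ n → begin
    ι (suc n) * ((a * (a ^ᶜ n)) * fact (suc n) ⁻¹)  ≈⟨ solve 4 (λ i a p f → i :* ((a :* p) :* f) := a :* (p :* (i :* f))) refl _ _ _ _ ⟩
    a * ((a ^ᶜ n) * (ι (suc n) * fact (suc n) ⁻¹))  ≈⟨ *-congˡ (*-congˡ (fact⁻¹-step n)) ⟩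
    a * ((a ^ᶜ n) * fact n ⁻¹)                      ∎
    where open ≈-Reasoning

  sgn : ℕ → Carrier
  sgn k = (- 1#) ^ᶜ k

  D-log : ∀ n → D logS n ≈ sgn n
  D-log n = trans (sym (*-assoc _ _ _)) (trans (*-congʳ (*-comm _ _))
    (trans (*-assoc _ _ _) (trans (*-congˡ (⁻¹-inverse _ (char0 n))) (*-identityʳ _))))

  alternating-telescope : ∀ M (x : ℕ → Carrier) → sumTo M (λ k → sgn k * (x k + x (suc k))) ≈ x 0 - sgn M * x M
  alternating-telescope zero x = solve 1 (λ x → con (ℤ.+ 0) := x :- con (ℤ.+ 1) :* x) refl (x 0)
  alternating-telescope (suc M) x = trans (+-congʳ (alternating-telescope M x))
    (solve 4 (λ x0 s xM xM1 → (x0 :- s :* xM) :+ s :* (xM :+ xM1) := x0 :- ((:- con (ℤ.+ 1)) :* s) :* xM1)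
       refl (x 0) (sgn M) (x M) (x (suc M)))

  -- For h = 1 + G with G(0) = 0:  h · (log(1+t))'(G) = 1, i.e. (1+G) Σ (-G)^k = 1.
  log-derivative-inverse : ∀ h → h 0 ≈ 1# → h ⊛ compose (D logS) (h ⊖ const 1#) ≐ const 1#
  log-derivative-inverse h h0≈1 = coefficientwise λ n → begin
    (h ⊛ compose (D logS) G) n
      ≈⟨ Σ-cong< (suc n) (λ i i≤n → *-congˡ (trans (compose-extend (D logS) G G0≈0 (n ∸ i) (suc n) (s≤s (ℕP.m∸n≤m n i)))
                                                  (Σ-cong (suc n) (λ k → *-congʳ (D-log k))))) ⟩
    sumTo (suc n) (λ i → h i * sumTo (suc n) (λ k → sgn k * powN G k (n ∸ i)))
      ≈⟨ trans (Σ-cong (suc n) (λ i → Σ-*ˡ (suc n) _ _)) (Σ-swap (suc n) (suc n) _) ⟩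
    sumTo (suc n) (λ k → sumTo (suc n) (λ i → h i * (sgn k * powN G k (n ∸ i))))
      ≈⟨ Σ-cong (suc n) (λ k → trans (Σ-cong (suc n) (λ i → solve 3 (λ x y z → x :* (y :* z) := y :* (x :* z)) refl _ _ _))
                                     (sym (Σ-*ˡ (suc n) _ _))) ⟩
    sumTo (suc n) (λ k → sgn k * (h ⊛ powN G k) n)
      ≈⟨ Σ-cong (suc n) (λ k → *-congˡ (at (hGᵏ k) n)) ⟩
    sumTo (suc n) (λ k → sgn k * (powN G k n + powN G (suc k) n))
      ≈⟨ alternating-telescope (suc n) (λ k → powN G k n) ⟩
    powN G 0 n - sgn (suc n) * powN G (suc n) n
      ≈⟨ +-congˡ (-‿cong (trans (*-congˡ (powN-order G G0≈0 (suc n) n ℕP.≤-refl)) (zeroʳ _))) ⟩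
    const 1# n - 0#
      ≈⟨ trans (+-congˡ -0#≈0#) (+-identityʳ _) ⟩
    const 1# n ∎
    where
    open ≈-Reasoning
    G : Series
    G = h ⊖ const 1#
    G0≈0 : G 0 ≈ 0#
    G0≈0 = trans (+-congʳ h0≈1) (-‿inverseʳ _)
    hGᵏ : ∀ k → h ⊛ powN G k ≐ powN G k ⊕ powN G (suc k)
    hGᵏ k = SR.trans (⊛-congʳ (powN G k) h≐1+G)
              (SR.trans (SR.distribʳ (powN G k) (const 1#) G) (⊕-congʳ (G ⊛ powN G k) (SR.*-identityˡ (powN G k))))
      where
      h≐1+G : h ≐ const 1# ⊕ G
      h≐1+G = solveₛ 1 (λ h → h SS.:= SS.con (ℤ.+ 1) SS.:+ (h SS.:- SS.con (ℤ.+ 1))) SR.refl h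

  logOf-at-0 : ∀ h → logOf h 0 ≈ 0#
  logOf-at-0 h = compose-at-0 logS (h ⊖ const 1#)

  D-logOf : ∀ h → h 0 ≈ 1# → h ⊛ D (logOf h) ≐ D h
  D-logOf h h0≈1 = begin
    h ⊛ D (logOf h)                  ≈⟨ ⊛-congˡ h (chain-rule logS G G0≈0) ⟩
    h ⊛ (compose (D logS) G ⊛ D G)   ≈⟨ SR.sym (SR.*-assoc h (compose (D logS) G) (D G)) ⟩
    (h ⊛ compose (D logS) G) ⊛ D G   ≈⟨ ⊛-congʳ (D G) (log-derivative-inverse h h0≈1) ⟩
    const 1# ⊛ D G                   ≈⟨ SR.*-identityˡ (D G) ⟩
    D G                              ≈⟨ SR.trans (D-⊕ h (negS (const 1#))) (⊕-congˡ (D h) D-neg1) ⟩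
    D h ⊕ const 0#                   ≈⟨ SR.+-identityʳ (D h) ⟩
    D h                              ∎
    where
    open ≐-Reasoning
    G : Series
    G = h ⊖ const 1#
    G0≈0 : G 0 ≈ 0#
    G0≈0 = trans (+-congʳ h0≈1) (-‿inverseʳ _)
    D-neg1 : D (negS (const 1#)) ≐ const 0#
    D-neg1 = SR.trans (D-neg (const 1#)) (SR.trans (SR.-‿cong (D-const 1#)) (coefficientwise λ { zero → -0#≈0# ; (suc n) → -0#≈0# }))

  -- Powers h^a = exp(a·log h) of series with h(0) = 1.  All their properties
  -- follow from the differential equation  h·(h^a)' = a·h'·h^a  and ode-unique.

  powS-at-0 : ∀ h a → powS h a 0 ≈ 1#
  powS-at-0 h a = trans (compose-at-0 (expS 1#) (scale a (logOf h))) (exp-at-0 1#)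

  powS-ode : ∀ h a → h 0 ≈ 1# → h ⊛ D (powS h a) ≐ (const a ⊛ D h) ⊛ powS h a
  powS-ode h a h0≈1 = begin
    h ⊛ D (powS h a)                              ≈⟨ ⊛-congˡ h (chain-rule (expS 1#) U U0≈0) ⟩
    h ⊛ (compose (D (expS 1#)) U ⊛ D U)           ≈⟨ ⊛-congˡ h (⊛-congʳ (D U) (compose-congˡ U exp′≐exp)) ⟩
    h ⊛ (powS h a ⊛ D U)                          ≈⟨ ⊛-congˡ h (⊛-congˡ (powS h a) (SR.trans (D-scale a (logOf h)) (scale≐const-⊛ a (D (logOf h))))) ⟩
    h ⊛ (powS h a ⊛ (const a ⊛ D (logOf h)))      ≈⟨ solveₛ 4 (λ h p a l → h SS.:* (p SS.:* (a SS.:* l)) SS.:= (a SS.:* (h SS.:* l)) SS.:* p)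
                                                       SR.refl h (powS h a) (const a) (D (logOf h)) ⟩
    (const a ⊛ (h ⊛ D (logOf h))) ⊛ powS h a      ≈⟨ ⊛-congʳ (powS h a) (⊛-congˡ (const a) (D-logOf h h0≈1)) ⟩
    (const a ⊛ D h) ⊛ powS h a                    ∎
    where
    open ≐-Reasoning
    U : Series
    U = scale a (logOf h)
    U0≈0 : U 0 ≈ 0#
    U0≈0 = trans (*-congˡ (logOf-at-0 h)) (zeroʳ _)
    exp′≐exp : D (expS 1#) ≐ expS 1#
    exp′≐exp = SR.trans (D-exp 1#) (coefficientwise λ n → *-identityˡ _)

  recip-inverse : ∀ h → h 0 ≈ 1# → recip h ⊛ h ≐ const 1#
  recip-inverse h h0≈1 = ode-unique-one h (recip h ⊛ h) ((const (- 1#) ⊛ D h) ⊕ D h) h0≈1 coefficient≐0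
    (ode-⊛ h (recip h) h (const (- 1#) ⊛ D h) (D h) (powS-ode h (- 1#) h0≈1) (SR.*-comm h (D h)))
    (trans (⊛-at-0 (recip h) h) (trans (*-cong (powS-at-0 h (- 1#)) h0≈1) (*-identityˡ _)))
    where
    coefficient≐0 : (const (- 1#) ⊛ D h) ⊕ D h ≐ const 0#
    coefficient≐0 = SR.trans (⊕-congʳ (D h) (⊛-congʳ (D h) (const-neg 1#)))
      (solveₛ 1 (λ d → (SS.:- SS.con (ℤ.+ 1)) SS.:* d SS.:+ d SS.:= SS.con (ℤ.+ 0)) SR.refl (D h))

  powS-natural : ∀ h → h 0 ≈ 1# → ∀ k → powS h (ι k) ≐ powN h k
  powS-natural h h0≈1 k = ode-unique h (const (ι k) ⊛ D h) (powS h (ι k)) (powN h k) h0≈1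
    (powS-ode h (ι k) h0≈1) (ode-powN h h (D h) (SR.*-comm h (D h)) k)
    (trans (powS-at-0 h (ι k)) (sym (powN-at-0 h h0≈1 k)))

  powS-recip : ∀ h a → h 0 ≈ 1# → powS h a ⊛ powS (recip h) a ≐ const 1#
  powS-recip h a h0≈1 = ode-unique-one h (hᵃ ⊛ Q) ((const a ⊛ D h) ⊕ negS (const a ⊛ D h)) h0≈1
    (SR.-‿inverseʳ (const a ⊛ D h))
    (ode-⊛ h hᵃ Q (const a ⊛ D h) (negS (const a ⊛ D h)) (powS-ode h a h0≈1) eqQ)
    (trans (⊛-at-0 hᵃ Q) (trans (*-cong (powS-at-0 h a) (powS-at-0 h⁻¹ a)) (*-identityˡ _)))
    where
    hᵃ : Series
    hᵃ = powS h a
    h⁻¹ : Series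
    h⁻¹ = recip h
    Q : Series
    Q = powS h⁻¹ a
    -- Q satisfies the equation of h^{-a}, written with h as leading coefficient
    eqQ : h ⊛ D Q ≐ negS (const a ⊛ D h) ⊛ Q
    eqQ = begin
      h ⊛ D Q                                   ≈⟨ ⊛-congˡ h (SR.sym (SR.*-identityˡ (D Q))) ⟩
      h ⊛ (const 1# ⊛ D Q)                      ≈⟨ ⊛-congˡ h (⊛-congʳ (D Q) (SR.sym (recip-inverse h h0≈1))) ⟩
      h ⊛ ((h⁻¹ ⊛ h) ⊛ D Q)                     ≈⟨ solveₛ 4 (λ h r q dq → h SS.:* ((r SS.:* h) SS.:* dq) SS.:= (h SS.:* h) SS.:* (r SS.:* dq))
                                                     SR.refl h h⁻¹ Q (D Q) ⟩
      (h ⊛ h) ⊛ (h⁻¹ ⊛ D Q)                     ≈⟨ ⊛-congˡ (h ⊛ h) (powS-ode h⁻¹ a (powS-at-0 h (- 1#))) ⟩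
      (h ⊛ h) ⊛ ((const a ⊛ D h⁻¹) ⊛ Q)         ≈⟨ solveₛ 4 (λ h a dr q → (h SS.:* h) SS.:* ((a SS.:* dr) SS.:* q)
                                                     SS.:= ((a SS.:* h) SS.:* (h SS.:* dr)) SS.:* q) SR.refl h (const a) (D h⁻¹) Q ⟩
      ((const a ⊛ h) ⊛ (h ⊛ D h⁻¹)) ⊛ Q         ≈⟨ ⊛-congʳ Q (⊛-congˡ (const a ⊛ h) (powS-ode h (- 1#) h0≈1)) ⟩
      ((const a ⊛ h) ⊛ ((const (- 1#) ⊛ D h) ⊛ h⁻¹)) ⊛ Q
                                                ≈⟨ ⊛-congʳ Q (⊛-congˡ (const a ⊛ h) (⊛-congʳ h⁻¹ (⊛-congʳ (D h) (const-neg 1#)))) ⟩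
      ((const a ⊛ h) ⊛ ((negS (const 1#) ⊛ D h) ⊛ h⁻¹)) ⊛ Q
                                                ≈⟨ solveₛ 5 (λ a h dh r q → ((a SS.:* h) SS.:* (((SS.:- SS.con (ℤ.+ 1)) SS.:* dh) SS.:* r)) SS.:* q
                                                     SS.:= (SS.:- (a SS.:* dh)) SS.:* ((r SS.:* h) SS.:* q)) SR.refl (const a) h (D h) h⁻¹ Q ⟩
      negS (const a ⊛ D h) ⊛ ((h⁻¹ ⊛ h) ⊛ Q)    ≈⟨ ⊛-congˡ (negS (const a ⊛ D h)) (SR.trans (⊛-congʳ Q (recip-inverse h h0≈1)) (SR.*-identityˡ Q)) ⟩
      negS (const a ⊛ D h) ⊛ Q                  ∎
      where open ≐-Reasoning

  onePlusT : Series
  onePlusT = const 1# ⊕ T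

  binom-at-0 : ∀ a → binomS a 0 ≈ 1#
  binom-at-0 a = trans (*-identityˡ _) 1⁻¹≈1

  binom-ode : ∀ a → onePlusT ⊛ D (binomS a) ≐ const a ⊛ binomS a
  binom-ode a = SR.trans onePlusT⊛ (SR.trans (coefficientwise coefficient) (scale≐const-⊛ a (binomS a)))
    where
    open ≈-Reasoning
    onePlusT⊛ : onePlusT ⊛ D (binomS a) ≐ D (binomS a) ⊕ mulT (D (binomS a))
    onePlusT⊛ = SR.trans (SR.distribʳ (D (binomS a)) (const 1#) T)
      (SR.+-cong (SR.*-identityˡ (D (binomS a))) (SR.sym (mulT≐T⊛ (D (binomS a)))))
    D-binom : ∀ m → D (binomS a) m ≈ falling a (suc m) * fact m ⁻¹
    D-binom m = trans (solve 3 (λ i x u → i :* (x :* u) := x :* (i :* u)) refl _ _ _) (*-congˡ (fact⁻¹-step m))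
    coefficient : ∀ n → (D (binomS a) ⊕ mulT (D (binomS a))) n ≈ scale a (binomS a) n
    coefficient zero = trans (+-congʳ (D-binom 0))
      (solve 2 (λ a f → (con (ℤ.+ 1) :* (a :- con (ℤ.+ 0))) :* f :+ con (ℤ.+ 0) := a :* (con (ℤ.+ 1) :* f)) refl a (fact 0 ⁻¹))
    coefficient (suc m) = begin
      D (binomS a) (suc m) + D (binomS a) m
        ≈⟨ +-cong (D-binom (suc m)) (trans (D-binom m) (*-congˡ (sym (fact⁻¹-step m)))) ⟩
      (falling a (suc m) * (a - ι (suc m))) * fact (suc m) ⁻¹ + falling a (suc m) * (ι (suc m) * fact (suc m) ⁻¹)
        ≈⟨ solve 4 (λ x a i u → (x :* (a :- i)) :* u :+ x :* (i :* u) := a :* (x :* u)) refl (falling a (suc m)) a (ι (suc m)) (fact (suc m) ⁻¹) ⟩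
      a * (falling a (suc m) * fact (suc m) ⁻¹) ∎

  binom-power-inverse : ∀ a k → powN (binomS a) k ⊛ binomS (- (ι k * a)) ≐ const 1#
  binom-power-inverse a k = ode-unique-one onePlusT Y ((const (ι k) ⊛ const a) ⊕ const (- (ι k * a)))
    (+-identityʳ _) coefficient≐0
    (ode-⊛ onePlusT (powN (binomS a) k) (binomS (- (ι k * a))) (const (ι k) ⊛ const a) (const (- (ι k * a)))
      (ode-powN onePlusT (binomS a) (const a) (binom-ode a) k) (binom-ode (- (ι k * a))))
    (trans (⊛-at-0 (powN (binomS a) k) (binomS (- (ι k * a))))
      (trans (*-cong (powN-at-0 (binomS a) (binom-at-0 a) k) (binom-at-0 (- (ι k * a)))) (*-identityˡ _)))
    where
    Y : Series
    Y = powN (binomS a) k ⊛ binomS (- (ι k * a))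
    coefficient≐0 : (const (ι k) ⊛ const a) ⊕ const (- (ι k * a)) ≐ const 0#
    coefficient≐0 = SR.trans (SR.sym (SR.trans (const-+ (ι k * a) (- (ι k * a))) (⊕-congʳ (const (- (ι k * a))) (const-* (ι k) a))))
      (const-cong (-‿inverseʳ _))

  D-inverse : ∀ W B → W ⊛ B ≐ const 1# → D W ⊛ B ≐ negS (W ⊛ D B)
  D-inverse W B WB≐1 = begin
    D W ⊛ B                                       ≈⟨ solveₛ 2 (λ x y → x SS.:= (x SS.:+ y) SS.:- y) SR.refl (D W ⊛ B) (W ⊛ D B) ⟩
    ((D W ⊛ B) ⊕ (W ⊛ D B)) ⊕ negS (W ⊛ D B)      ≈⟨ ⊕-congʳ (negS (W ⊛ D B)) (SR.trans (SR.sym (D-⊛ W B)) (SR.trans (D-cong WB≐1) (D-const 1#))) ⟩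
    const 0# ⊕ negS (W ⊛ D B)                     ≈⟨ SR.+-identityˡ (negS (W ⊛ D B)) ⟩
    negS (W ⊛ D B)                                ∎
    where open ≐-Reasoning

  module Lagrange (E H : Series) (n : ℕ) (HEⁿ≐1 : H ⊛ powN E n ≐ const 1#) where

    f : Series
    f = T ⊛ E

    -- H·(f^{j+1})' = t^j · X j
    X : ℕ → Series
    X j = const (ι (suc j)) ⊛ ((H ⊛ powN E (suc j)) ⊕ (T ⊛ ((H ⊛ powN E j) ⊛ D E)))

    X-at : ∀ j i → X j i ≈ ι (suc j) * ((H ⊛ powN E (suc j)) i + mulT ((H ⊛ powN E j) ⊛ D E) i)
    X-at j i = trans (sym (at (scale≐const-⊛ (ι (suc j)) ((H ⊛ powN E (suc j)) ⊕ (T ⊛ ((H ⊛ powN E j) ⊛ D E)))) i))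
      (*-congˡ (+-congˡ (sym (at (mulT≐T⊛ ((H ⊛ powN E j) ⊛ D E)) i))))

    expansion : ∀ j → H ⊛ D (powN f (suc j)) ≐ powN T j ⊛ X j
    expansion j = begin
      H ⊛ D (powN f (suc j))
        ≈⟨ ⊛-congˡ H (D-powN f j) ⟩
      H ⊛ (const (ι (suc j)) ⊛ (powN f j ⊛ D f))
        ≈⟨ ⊛-congˡ H (⊛-congˡ (const (ι (suc j))) (SR.*-cong (powN-⊛ T E j) D-f)) ⟩
      H ⊛ (const (ι (suc j)) ⊛ ((powN T j ⊛ powN E j) ⊛ (E ⊕ (T ⊛ D E))))
        ≈⟨ solveₛ 7 (λ h c tj ej e t de → h SS.:* (c SS.:* ((tj SS.:* ej) SS.:* (e SS.:+ (t SS.:* de))))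
                        SS.:= tj SS.:* (c SS.:* ((h SS.:* (e SS.:* ej)) SS.:+ (t SS.:* ((h SS.:* ej) SS.:* de)))))
                     SR.refl H (const (ι (suc j))) (powN T j) (powN E j) E T (D E) ⟩
      powN T j ⊛ X j ∎
      where
      open ≐-Reasoning
      D-f : D f ≐ E ⊕ (T ⊛ D E)
      D-f = SR.trans (D-⊛ T E) (⊕-congʳ (T ⊛ D E) (SR.trans (⊛-congʳ E D-T) (SR.*-identityˡ E)))

    -- For n = (j+1)+(q+1), the coefficient X j (q+1) vanishes: with W = H·E^{j+1}
    -- and B = E^{q+1} we have W·B = 1, and (q+1)·H·E^j·E' = -W'.
    module CrossTerm (j q : ℕ) (n≡ : n ≡ suc j ℕ.+ suc q) where
      Eʲ : Series
      Eʲ = powN E j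
      B : Series
      B = powN E (suc q)
      W : Series
      W = H ⊛ powN E (suc j)
      Z : Series
      Z = (H ⊛ Eʲ) ⊛ D E
      q+1 : Series
      q+1 = const (ι (suc q))

      Eⁿ-split : powN E n ≐ (E ⊛ Eʲ) ⊛ B
      Eⁿ-split = SR.trans (SR.reflexive (P.cong (powN E) n≡)) (powN-+ E (suc j) (suc q))

      H⊛Eⁿ-split≐1 : H ⊛ ((E ⊛ Eʲ) ⊛ B) ≐ const 1#
      H⊛Eⁿ-split≐1 = SR.trans (⊛-congˡ H (SR.sym Eⁿ-split)) HEⁿ≐1

      W⊛B≐1 : W ⊛ B ≐ const 1#
      W⊛B≐1 = SR.trans (SR.*-assoc H (E ⊛ Eʲ) B) H⊛Eⁿ-split≐1

      -- both (q+1)·Z and -W' equal (q+1)·E^j·E' after multiplication by E^n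
      scaled-Z : (q+1 ⊛ Z) ⊛ powN E n ≐ (q+1 ⊛ Eʲ) ⊛ D E
      scaled-Z = begin
        (q+1 ⊛ Z) ⊛ powN E n                  ≈⟨ ⊛-congˡ (q+1 ⊛ Z) Eⁿ-split ⟩
        (q+1 ⊛ Z) ⊛ ((E ⊛ Eʲ) ⊛ B)            ≈⟨ solveₛ 6 (λ c h ej de e b → (c SS.:* ((h SS.:* ej) SS.:* de)) SS.:* ((e SS.:* ej) SS.:* b)
                                                   SS.:= ((c SS.:* ej) SS.:* de) SS.:* (h SS.:* ((e SS.:* ej) SS.:* b))) SR.refl q+1 H Eʲ (D E) E B ⟩
        ((q+1 ⊛ Eʲ) ⊛ D E) ⊛ (H ⊛ ((E ⊛ Eʲ) ⊛ B))  ≈⟨ ⊛-congˡ ((q+1 ⊛ Eʲ) ⊛ D E) H⊛Eⁿ-split≐1 ⟩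
        ((q+1 ⊛ Eʲ) ⊛ D E) ⊛ const 1#         ≈⟨ SR.*-identityʳ ((q+1 ⊛ Eʲ) ⊛ D E) ⟩
        (q+1 ⊛ Eʲ) ⊛ D E                      ∎
        where open ≐-Reasoning

      scaled-W′ : negS (D W) ⊛ powN E n ≐ (q+1 ⊛ Eʲ) ⊛ D E
      scaled-W′ = begin
        negS (D W) ⊛ powN E n                 ≈⟨ ⊛-congˡ (negS (D W)) Eⁿ-split ⟩
        negS (D W) ⊛ ((E ⊛ Eʲ) ⊛ B)           ≈⟨ solveₛ 4 (λ dw e ej b → (SS.:- dw) SS.:* ((e SS.:* ej) SS.:* b)
                                                   SS.:= (e SS.:* ej) SS.:* (SS.:- (dw SS.:* b))) SR.refl (D W) E Eʲ B ⟩
        (E ⊛ Eʲ) ⊛ negS (D W ⊛ B)             ≈⟨ ⊛-congˡ (E ⊛ Eʲ) (SR.trans (SR.-‿cong (D-inverse W B W⊛B≐1)) (coefficientwise λ i → -‿involutive _)) ⟩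
        (E ⊛ Eʲ) ⊛ (W ⊛ D B)                  ≈⟨ ⊛-congˡ (E ⊛ Eʲ) (⊛-congˡ W (D-powN E q)) ⟩
        (E ⊛ Eʲ) ⊛ (W ⊛ (q+1 ⊛ (powN E q ⊛ D E)))
                                              ≈⟨ solveₛ 6 (λ e ej w c eq de → (e SS.:* ej) SS.:* (w SS.:* (c SS.:* (eq SS.:* de)))
                                                   SS.:= ((c SS.:* ej) SS.:* de) SS.:* (w SS.:* (e SS.:* eq))) SR.refl E Eʲ W q+1 (powN E q) (D E) ⟩
        ((q+1 ⊛ Eʲ) ⊛ D E) ⊛ (W ⊛ B)          ≈⟨ ⊛-congˡ ((q+1 ⊛ Eʲ) ⊛ D E) W⊛B≐1 ⟩
        ((q+1 ⊛ Eʲ) ⊛ D E) ⊛ const 1#         ≈⟨ SR.*-identityʳ ((q+1 ⊛ Eʲ) ⊛ D E) ⟩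
        (q+1 ⊛ Eʲ) ⊛ D E                      ∎
        where open ≐-Reasoning

      Z-at-q : Z q ≈ - W (suc q)
      Z-at-q = cancelˡ (char0 q) (begin
        ι (suc q) * Z q            ≈⟨ at (scale≐const-⊛ (ι (suc q)) Z) q ⟩
        (q+1 ⊛ Z) q                ≈⟨ at (cancel-power E H n HEⁿ≐1 (q+1 ⊛ Z) (negS (D W)) (SR.trans scaled-Z (SR.sym scaled-W′))) q ⟩
        - (ι (suc q) * W (suc q))  ≈⟨ -‿distribʳ-* _ _ ⟩
        ι (suc q) * - W (suc q)    ∎)
        where open ≈-Reasoning

      vanishes : W (suc q) + Z q ≈ 0#
      vanishes = trans (+-congˡ Z-at-q) (-‿inverseʳ _)

    coefficient-diagonal : ∀ m → n ≡ suc m → (H ⊛ D (powN f n)) m ≈ ι n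
    coefficient-diagonal m P.refl = begin
      (H ⊛ D (powN f (suc m))) m       ≈⟨ at (expansion m) m ⟩
      (powN T m ⊛ X m) m               ≈⟨ reflexive (P.cong (powN T m ⊛ X m) (P.sym (ℕP.+-identityʳ m))) ⟩
      (powN T m ⊛ X m) (m ℕ.+ 0)       ≈⟨ T^-at m (X m) 0 ⟩
      X m 0                            ≈⟨ X-at m 0 ⟩
      ι (suc m) * ((H ⊛ powN E (suc m)) 0 + 0#)  ≈⟨ *-congˡ (trans (+-identityʳ _) (at HEⁿ≐1 0)) ⟩
      ι (suc m) * 1#                   ≈⟨ *-identityʳ _ ⟩
      ι (suc m)                        ∎
      where open ≈-Reasoning

    coefficient-off-diagonal : ∀ m → n ≡ suc m → ∀ k → ¬ (k ≡ n) → (H ⊛ D (powN f k)) m ≈ 0#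
    coefficient-off-diagonal m n≡ zero _ =
      trans (at (⊛-congˡ H (D-const 1#)) m) (Σ-zero (suc m) (λ i _ → trans (*-congˡ (const-0-at (m ∸ i))) (zeroʳ _)))
    coefficient-off-diagonal m n≡ (suc j) k≢n with ℕP.<-cmp m j
    ... | tri< m<j _ _ = trans (at (expansion j) m) (T^-below j (X j) m m<j)
    ... | tri≈ _ m≡j _ = ⊥-elim (k≢n (P.trans (P.cong suc (P.sym m≡j)) (P.sym n≡)))
    ... | tri> _ _ j<m = begin
      (H ⊛ D (powN f (suc j))) m         ≈⟨ at (expansion j) m ⟩
      (powN T j ⊛ X j) m                 ≈⟨ reflexive (P.cong (powN T j ⊛ X j) m≡) ⟩
      (powN T j ⊛ X j) (j ℕ.+ suc q)     ≈⟨ T^-at j (X j) (suc q) ⟩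
      X j (suc q)                        ≈⟨ X-at j (suc q) ⟩
      ι (suc j) * ((H ⊛ powN E (suc j)) (suc q) + ((H ⊛ powN E j) ⊛ D E) q)
                                         ≈⟨ *-congˡ (CrossTerm.vanishes j q (P.trans n≡ (P.cong suc m≡))) ⟩
      ι (suc j) * 0#                     ≈⟨ zeroʳ _ ⟩
      0#                                 ∎
      where
      open ≈-Reasoning
      q : ℕ
      q = m ∸ suc j
      m≡ : m ≡ j ℕ.+ suc q
      m≡ = P.trans (P.sym (ℕP.m+[n∸m]≡n j<m)) (P.sym (ℕP.+-suc j q))

  coef : Poly → ℕ → Carrier
  coef [] j = 0#
  coef (a ∷ p) zero = a
  coef (a ∷ p) (suc j) = coef p j

  eval-as-sum : ∀ p x M → length p ≤ M → eval p x ≈ sumTo M (λ j → coef p j * x ^ᶜ j)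
  eval-as-sum [] x M _ = sym (Σ-zero M (λ i _ → zeroˡ _))
  eval-as-sum (a ∷ p) x (suc M) (s≤s len≤M) = begin
    a + x * eval p x
      ≈⟨ +-cong (sym (*-identityʳ a)) (trans (*-congˡ (eval-as-sum p x M len≤M))
           (trans (Σ-*ˡ M x _) (Σ-cong M (λ j → solve 3 (λ x c y → x :* (c :* y) := c :* (x :* y)) refl _ _ _)))) ⟩
    a * 1# + sumTo M (λ j → coef p j * (x * x ^ᶜ j))
      ≈⟨ sym (Σ-first M _) ⟩
    sumTo (suc M) (λ j → coef (a ∷ p) j * x ^ᶜ j) ∎
    where open ≈-Reasoning

  pairing-as-sum : ∀ p s h M → length p ≤ M →
                   pairFrom s h p ≈ sumTo M (λ j → (fact (s ℕ.+ j) * h (s ℕ.+ j)) * coef p j)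
  pairing-as-sum [] s h M _ = sym (Σ-zero M (λ i _ → zeroʳ _))
  pairing-as-sum (a ∷ p) s h (suc M) (s≤s len≤M) = begin
    (fact s * h s) * a + pairFrom (suc s) h p
      ≈⟨ +-cong (reflexive (P.cong (λ k → (fact k * h k) * a) (P.sym (ℕP.+-identityʳ s))))
                (trans (pairing-as-sum p (suc s) h M len≤M)
                       (Σ-cong M (λ j → reflexive (P.cong (λ k → (fact k * h k) * coef p j) (P.sym (ℕP.+-suc s j)))))) ⟩
    (fact (s ℕ.+ 0) * h (s ℕ.+ 0)) * a + sumTo M (λ j → (fact (s ℕ.+ suc j) * h (s ℕ.+ suc j)) * coef p j)
      ≈⟨ sym (Σ-first M _) ⟩
    sumTo (suc M) (λ j → (fact (s ℕ.+ j) * h (s ℕ.+ j)) * coef (a ∷ p) j) ∎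
    where open ≈-Reasoning

  record Triangular (G : ℕ → Series) : Set ℓ where
    field
      below    : ∀ k i → i < k → G k i ≈ 0#
      diagonal : ∀ k → G k k ≈ 1#

  triangular-unique : ∀ M G (d : ℕ → Carrier) → Triangular G →
    (∀ k → sumTo M (λ j → (fact j * G k j) * d j) ≈ 0#) → ∀ j → j < M → d j ≈ 0#
  triangular-unique M G d tri pairings≈0 j j<M = downward M j (ℕP.≤-trans (ℕP.m≤m+n M j) (ℕP.n≤1+n _)) j<M
    where
    open Triangular tri
    -- if d vanishes above j, the k = j pairing reduces to j!·d_j
    step : ∀ j → j < M → (∀ i → j < i → i < M → d i ≈ 0#) → d j ≈ 0#
    step j j<M above = cancel-zero (fact-nonzero j)
      (trans (*-congʳ (sym (trans (*-congˡ (diagonal j)) (*-identityʳ _))))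
        (trans (sym (Σ-single M j _ j<M others)) (pairings≈0 j)))
      where
      others : ∀ i → i < M → ¬ i ≡ j → (fact i * G j i) * d i ≈ 0#
      others i i<M i≢j with ℕP.<-cmp i j
      ... | tri< i<j _ _ = trans (*-congʳ (trans (*-congˡ (below j i i<j)) (zeroʳ _))) (zeroˡ _)
      ... | tri≈ _ i≡j _ = ⊥-elim (i≢j i≡j)
      ... | tri> _ _ j<i = trans (*-congˡ (above i j<i i<M)) (zeroʳ _)
    -- downward induction: t bounds the number of indices above j
    downward : ∀ t j → M ≤ suc (t ℕ.+ j) → j < M → d j ≈ 0#
    downward zero j M≤1+j j<M = step j j<M
      (λ i j<i i<M → ⊥-elim (ℕP.<-irrefl P.refl (ℕP.<-≤-trans i<M (ℕP.≤-trans M≤1+j j<i))))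
    downward (suc t) j M≤ j<M = step j j<M (λ i j<i i<M → downward t i
      (ℕP.≤-trans M≤ (s≤s (ℕP.≤-trans (ℕP.≤-reflexive (P.sym (ℕP.+-suc t j))) (ℕP.+-monoʳ-≤ t j<i)))) i<M)

  pairing-determines-coefficients : ∀ M G (p : Poly) (P : ℕ → Carrier) → Triangular G → length p ≤ M →
    (∀ k → ⟨ G k ∣ p ⟩ ≈ sumTo M (λ j → (fact j * G k j) * P j)) → ∀ j → j < M → coef p j ≈ P j
  pairing-determines-coefficients M G p P tri len≤M same-pairings j j<M =
    trans (solve 2 (λ a b → a := (a :- b) :+ b) refl _ _)
      (trans (+-congʳ (triangular-unique M G (λ j → coef p j - P j) tri difference≈0 j j<M)) (+-identityˡ _))
    where
    open ≈-Reasoning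
    difference≈0 : ∀ k → sumTo M (λ j → (fact j * G k j) * (coef p j - P j)) ≈ 0#
    difference≈0 k = begin
      sumTo M (λ j → (fact j * G k j) * (coef p j - P j))
        ≈⟨ Σ-cong M (λ j → solve 3 (λ w a b → w :* (a :- b) := w :* a :+ (:- (w :* b))) refl _ _ _) ⟩
      sumTo M (λ j → (fact j * G k j) * coef p j + - ((fact j * G k j) * P j))
        ≈⟨ trans (Σ-+ M _ _) (+-congˡ (sym (Σ-neg M _))) ⟩
      sumTo M (λ j → (fact j * G k j) * coef p j) - sumTo M (λ j → (fact j * G k j) * P j)
        ≈⟨ +-congʳ (sym (pairing-as-sum p 0 (G k) M len≤M)) ⟩
      ⟨ G k ∣ p ⟩ - sumTo M (λ j → (fact j * G k j) * P j)
        ≈⟨ +-congʳ (same-pairings k) ⟩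
      sumTo M (λ j → (fact j * G k j) * P j) - sumTo M (λ j → (fact j * G k j) * P j)
        ≈⟨ -‿inverseʳ _ ⟩
      0# ∎

  factδ-diagonal : ∀ n → factδ n n ≈ fact n
  factδ-diagonal n with n ℕ.≡ᵇ n | ℕP.≡⇒≡ᵇ n n P.refl
  ... | true | _ = refl

  factδ-off-diagonal : ∀ n k → ¬ (n ≡ k) → factδ n k ≈ 0#
  factδ-off-diagonal n k n≢k with n ℕ.≡ᵇ n | n ℕ.≡ᵇ k in n≡ᵇk
  ... | _ | true = ⊥-elim (n≢k (ℕP.≡ᵇ⇒≡ n k (P.subst Bool.T (P.sym n≡ᵇk) _)))
  ... | _ | false = refl

  module Proposition8Series (lam α cc : Carrier) (lam≉1 : ¬ (lam ≈ 1#)) where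

    L0≈1 : logDivT 0 ≈ 1#
    L0≈1 = trans (*-identityˡ _) (sym (inverse-unique (char0 0) (trans (*-identityʳ _) (+-identityʳ _))))

    E : Series
    E = binomS cc ⊛ recip logDivT

    f≐T⊛E : fSeries cc ≐ T ⊛ E
    f≐T⊛E = mulT≐T⊛ E

    E0≈1 : E 0 ≈ 1#
    E0≈1 = trans (⊛-at-0 (binomS cc) (recip logDivT)) (trans (*-cong (binom-at-0 cc) (powS-at-0 logDivT (- 1#))) (*-identityˡ _))

    -- H n = (log(1+t)/t)^n (1+t)^{-nc}, whose coefficients are the Narumi numbers
    H : ℕ → Series
    H n = powS logDivT (ι n) ⊛ binomS (- (ι n * cc))

    H⊛Eⁿ≐1 : ∀ n → H n ⊛ powN E n ≐ const 1#
    H⊛Eⁿ≐1 n = begin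
      H n ⊛ powN E n
        ≈⟨ SR.*-cong (⊛-congʳ (binomS (- (ι n * cc))) (powS-natural logDivT L0≈1 n)) (powN-⊛ (binomS cc) (recip logDivT) n) ⟩
      (powN logDivT n ⊛ binomS (- (ι n * cc))) ⊛ (powN (binomS cc) n ⊛ powN (recip logDivT) n)
        ≈⟨ solveₛ 4 (λ l b bc r → (l SS.:* b) SS.:* (bc SS.:* r) SS.:= (bc SS.:* b) SS.:* (r SS.:* l))
             SR.refl (powN logDivT n) (binomS (- (ι n * cc))) (powN (binomS cc) n) (powN (recip logDivT) n) ⟩
      (powN (binomS cc) n ⊛ binomS (- (ι n * cc))) ⊛ (powN (recip logDivT) n ⊛ powN logDivT n)
        ≈⟨ SR.*-cong (binom-power-inverse cc n)
             (SR.trans (SR.sym (powN-⊛ (recip logDivT) logDivT n)) (SR.trans (powN-cong (recip-inverse logDivT L0≈1) n) (powN-one n))) ⟩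
      const 1# ⊛ const 1#
        ≈⟨ SR.*-identityˡ (const 1#) ⟩
      const 1# ∎
      where open ≐-Reasoning

    eulerBase-at-0 : eulerBase lam 0 ≈ 1#
    eulerBase-at-0 = trans (*-congˡ (+-congʳ (exp-at-0 (lam - 1#)))) (trans (*-comm _ _) (⁻¹-inverse _ 1-λ≉0))
      where
      1-λ≉0 : ¬ ((1# - lam) ≈ 0#)
      1-λ≉0 1-λ≈0 = lam≉1 (trans (solve 1 (λ l → l := con (ℤ.+ 1) :- (con (ℤ.+ 1) :- l)) refl lam)
                            (trans (+-congˡ (-‿cong 1-λ≈0)) (trans (+-congˡ -0#≈0#) (+-identityʳ _))))

    g : Series
    g = gSeries lam α

    -- Q = 1/g generates the Eulerian polynomials
    Q : Series
    Q = powS (recip (eulerBase lam)) α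

    g⊛Q≐1 : g ⊛ Q ≐ const 1#
    g⊛Q≐1 = powS-recip (eulerBase lam) α eulerBase-at-0

    gfᵏ : ℕ → Series
    gfᵏ k = g ⊛ powN (fSeries cc) k

    gfᵏ≐Tᵏ⊛ : ∀ k → gfᵏ k ≐ powN T k ⊛ (g ⊛ powN E k)
    gfᵏ≐Tᵏ⊛ k = SR.trans (⊛-congˡ g (SR.trans (powN-cong f≐T⊛E k) (powN-⊛ T E k)))
      (solveₛ 3 (λ g t e → g SS.:* (t SS.:* e) SS.:= t SS.:* (g SS.:* e)) SR.refl g (powN T k) (powN E k))

    gfᵏ-triangular : Triangular gfᵏ
    gfᵏ-triangular = record { below = below ; diagonal = diagonal }
      where
      below : ∀ k i → i < k → gfᵏ k i ≈ 0#
      below k i i<k = trans (at (gfᵏ≐Tᵏ⊛ k) i) (T^-below k (g ⊛ powN E k) i i<k)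
      diagonal : ∀ k → gfᵏ k k ≈ 1#
      diagonal k = begin
        gfᵏ k k                             ≈⟨ at (gfᵏ≐Tᵏ⊛ k) k ⟩
        (powN T k ⊛ (g ⊛ powN E k)) k       ≈⟨ reflexive (P.cong (powN T k ⊛ (g ⊛ powN E k)) (P.sym (ℕP.+-identityʳ k))) ⟩
        (powN T k ⊛ (g ⊛ powN E k)) (k ℕ.+ 0) ≈⟨ T^-at k (g ⊛ powN E k) 0 ⟩
        (g ⊛ powN E k) 0                    ≈⟨ ⊛-at-0 g (powN E k) ⟩
        g 0 * powN E k 0                    ≈⟨ *-cong (powS-at-0 (eulerBase lam) α) (powN-at-0 E E0≈1 k) ⟩
        1# * 1#                             ≈⟨ *-identityˡ _ ⟩
        1#                                  ∎
        where open ≈-Reasoning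

    -- coefficient of x^j in A_m^{(α)}(x|λ) = m!·[t^m] Q·e^{xt}:  m!/j!·Q_{m-j}  (j ≤ m)
    eulerianCoef : ℕ → ℕ → Carrier
    eulerianCoef m j with j ℕ.≤? m
    ... | yes _ = (fact m * Q (m ∸ j)) * fact j ⁻¹
    ... | no _ = 0#

    eulerianCoef-≤ : ∀ m j → j ≤ m → eulerianCoef m j ≈ (fact m * Q (m ∸ j)) * fact j ⁻¹
    eulerianCoef-≤ m j j≤m with j ℕ.≤? m
    ... | yes _ = refl
    ... | no j≰m = ⊥-elim (j≰m j≤m)

    eulerianCoef-> : ∀ m j → m < j → eulerianCoef m j ≈ 0#
    eulerianCoef-> m j m<j with j ℕ.≤? m
    ... | yes j≤m = ⊥-elim (ℕP.<-irrefl P.refl (ℕP.<-≤-trans m<j j≤m))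
    ... | no _ = refl

    eulerian-pairing : ∀ G m M → m < M → sumTo M (λ j → (fact j * G j) * eulerianCoef m j) ≈ fact m * (G ⊛ Q) m
    eulerian-pairing G m M m<M = begin
      sumTo M (λ j → (fact j * G j) * eulerianCoef m j)
        ≈⟨ Σ-truncate (suc m) M _ m<M (λ j m<j → trans (*-congˡ (eulerianCoef-> m j m<j)) (zeroʳ _)) ⟩
      sumTo (suc m) (λ j → (fact j * G j) * eulerianCoef m j)
        ≈⟨ Σ-cong< (suc m) (λ j j≤m → trans (*-congˡ (eulerianCoef-≤ m j (ℕP.≤-pred j≤m))) (cancel-fact j)) ⟩
      sumTo (suc m) (λ j → fact m * (G j * Q (m ∸ j)))
        ≈⟨ sym (Σ-*ˡ (suc m) _ _) ⟩
      fact m * (G ⊛ Q) m ∎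
      where
      open ≈-Reasoning
      cancel-fact : ∀ j → (fact j * G j) * ((fact m * Q (m ∸ j)) * fact j ⁻¹) ≈ fact m * (G j * Q (m ∸ j))
      cancel-fact j = trans (solve 5 (λ f g F q u → (f :* g) :* ((F :* q) :* u) := F :* ((g :* q) :* (f :* u))) refl _ _ _ _ _)
        (*-congˡ (trans (*-congˡ (⁻¹-inverse _ (fact-nonzero j))) (*-identityʳ _)))

    eulerian-eval : ∀ m M x → m < M → sumTo M (λ j → eulerianCoef m j * x ^ᶜ j) ≈ frobEuler m α x lam
    eulerian-eval m M x m<M = begin
      sumTo M (λ j → eulerianCoef m j * x ^ᶜ j)
        ≈⟨ Σ-truncate (suc m) M _ m<M (λ j m<j → trans (*-congʳ (eulerianCoef-> m j m<j)) (zeroˡ _)) ⟩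
      sumTo (suc m) (λ j → eulerianCoef m j * x ^ᶜ j)
        ≈⟨ Σ-cong< (suc m) (λ j j≤m → trans (*-congʳ (eulerianCoef-≤ m j (ℕP.≤-pred j≤m)))
             (solve 4 (λ F q u p → ((F :* q) :* u) :* p := F :* ((p :* u) :* q)) refl _ _ _ _)) ⟩
      sumTo (suc m) (λ j → fact m * (expS x j * Q (m ∸ j)))
        ≈⟨ sym (Σ-*ˡ (suc m) _ _) ⟩
      fact m * (expS x ⊛ Q) m
        ≈⟨ *-congˡ (at (⊛-comm (expS x) Q) m) ⟩
      fact m * (Q ⊛ expS x) m ∎
      where open ≈-Reasoning

    -- The right-hand side P_n(x) = Σ_{l<n} weight n l · A_{n-l}^{(α)}(x|λ), as a coefficient sequence
    weight : ℕ → ℕ → Carrier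
    weight n l = ι ((n ∸ 1) C l) * narumi l (ι n) (- (ι n * cc))

    candidate : ℕ → ℕ → Carrier
    candidate n j = sumTo n (λ l → weight n l * eulerianCoef (n ∸ l) j)

    candidate-eval : ∀ n M x → n < M → sumTo M (λ j → candidate n j * x ^ᶜ j) ≈ rhs n lam α cc x
    candidate-eval n M x n<M = begin
      sumTo M (λ j → candidate n j * x ^ᶜ j)
        ≈⟨ trans (Σ-cong M (λ j → Σ-*ʳ n _ _)) (Σ-swap M n _) ⟩
      sumTo n (λ l → sumTo M (λ j → (weight n l * eulerianCoef (n ∸ l) j) * x ^ᶜ j))
        ≈⟨ Σ-cong n (λ l → trans (Σ-cong M (λ j → *-assoc _ _ _)) (sym (Σ-*ˡ M _ _))) ⟩
      sumTo n (λ l → weight n l * sumTo M (λ j → eulerianCoef (n ∸ l) j * x ^ᶜ j))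
        ≈⟨ Σ-cong n (λ l → *-congˡ (eulerian-eval (n ∸ l) M x (ℕP.≤-<-trans (ℕP.m∸n≤m n l) n<M))) ⟩
      rhs n lam α cc x ∎
      where open ≈-Reasoning

    candidate-pairing-with : ∀ n G M → n < M →
      sumTo M (λ j → (fact j * G j) * candidate n j) ≈ sumTo n (λ l → weight n l * (fact (n ∸ l) * (G ⊛ Q) (n ∸ l)))
    candidate-pairing-with n G M n<M = begin
      sumTo M (λ j → (fact j * G j) * candidate n j)
        ≈⟨ trans (Σ-cong M (λ j → Σ-*ˡ n _ _)) (Σ-swap M n _) ⟩
      sumTo n (λ l → sumTo M (λ j → (fact j * G j) * (weight n l * eulerianCoef (n ∸ l) j)))
        ≈⟨ Σ-cong n (λ l → trans (Σ-cong M (λ j → solve 3 (λ w c a → w :* (c :* a) := c :* (w :* a)) refl _ _ _)) (sym (Σ-*ˡ M _ _))) ⟩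
      sumTo n (λ l → weight n l * sumTo M (λ j → (fact j * G j) * eulerianCoef (n ∸ l) j))
        ≈⟨ Σ-cong n (λ l → *-congˡ (eulerian-pairing G (n ∸ l) M (ℕP.≤-<-trans (ℕP.m∸n≤m n l) n<M))) ⟩
      sumTo n (λ l → weight n l * (fact (n ∸ l) * (G ⊛ Q) (n ∸ l))) ∎
      where open ≈-Reasoning

    weighted-sum≈derivative : ∀ m u → sumTo (suc m) (λ l → weight (suc m) l * (fact (suc m ∸ l) * u (suc m ∸ l))) ≈ fact m * (H (suc m) ⊛ D u) m
    weighted-sum≈derivative m u = begin
      sumTo (suc m) (λ l → weight (suc m) l * (fact (suc m ∸ l) * u (suc m ∸ l)))
        ≈⟨ Σ-cong< (suc m) (λ l l≤m → trans (reflexive (P.cong (λ i → weight (suc m) l * (fact i * u i)) (ℕP.+-∸-assoc 1 (ℕP.≤-pred l≤m))))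
                                              (term l (ℕP.≤-pred l≤m))) ⟩
      sumTo (suc m) (λ l → fact m * (H (suc m) l * D u (m ∸ l)))
        ≈⟨ sym (Σ-*ˡ (suc m) _ _) ⟩
      fact m * (H (suc m) ⊛ D u) m ∎
      where
      open ≈-Reasoning
      term : ∀ l → l ≤ m → weight (suc m) l * (fact (suc (m ∸ l)) * u (suc (m ∸ l))) ≈ fact m * (H (suc m) l * D u (m ∸ l))
      term l l≤m = trans (solve 6 (λ C fl h i fm v → (C :* (fl :* h)) :* ((i :* fm) :* v) := (C :* (fl :* fm)) :* (h :* (i :* v))) refl
                            (ι (m C l)) (fact l) (H (suc m) l) (ι (suc (m ∸ l))) (fact (m ∸ l)) (u (suc (m ∸ l))))
                         (*-congʳ (binomial-factorials l≤m))

    candidate-sheffer : ∀ m k M → suc m < M → sumTo M (λ j → (fact j * gfᵏ k j) * candidate (suc m) j) ≈ factδ (suc m) k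
    candidate-sheffer m k M n<M = begin
      sumTo M (λ j → (fact j * gfᵏ k j) * candidate n j)
        ≈⟨ candidate-pairing-with n (gfᵏ k) M n<M ⟩
      sumTo n (λ l → weight n l * (fact (n ∸ l) * (gfᵏ k ⊛ Q) (n ∸ l)))
        ≈⟨ Σ-cong n (λ l → *-congˡ (*-congˡ (at gfᵏQ≐fᵏ (n ∸ l)))) ⟩
      sumTo n (λ l → weight n l * (fact (n ∸ l) * powN f k (n ∸ l)))
        ≈⟨ weighted-sum≈derivative m (powN f k) ⟩
      fact m * (H n ⊛ D (powN f k)) m
        ≈⟨ *-congˡ (at (⊛-congˡ (H n) (D-cong (powN-cong f≐T⊛E k))) m) ⟩
      fact m * (H n ⊛ D (powN (T ⊛ E) k)) m
        ≈⟨ lagrange k ⟩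
      factδ n k ∎
      where
      open ≈-Reasoning
      n : ℕ
      n = suc m
      f : Series
      f = fSeries cc
      open Lagrange E (H n) n (H⊛Eⁿ≐1 n) using (coefficient-diagonal; coefficient-off-diagonal)
      gfᵏQ≐fᵏ : gfᵏ k ⊛ Q ≐ powN f k
      gfᵏQ≐fᵏ = SR.trans (solveₛ 3 (λ g p q → (g SS.:* p) SS.:* q SS.:= p SS.:* (g SS.:* q)) SR.refl g (powN f k) Q)
                         (SR.trans (⊛-congˡ (powN f k) g⊛Q≐1) (SR.*-identityʳ (powN f k)))
      lagrange : ∀ k → fact m * (H n ⊛ D (powN (T ⊛ E) k)) m ≈ factδ n k
      lagrange k with n ℕP.≟ k
      ... | yes P.refl = trans (*-congˡ (coefficient-diagonal m P.refl)) (trans (*-comm _ _) (sym (factδ-diagonal n)))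
      ... | no n≢k = trans (*-congˡ (coefficient-off-diagonal m P.refl k (λ k≡n → n≢k (P.sym k≡n))))
                           (trans (zeroʳ _) (sym (factδ-off-diagonal n k n≢k)))

-- Since g·f^k is triangular, the Sheffer conditions force the coefficients of
-- S_n to be those of the candidate P_n, whose value at x is the right-hand side.
proposition8 : ∀ {c ℓ} (F : CharZeroField c ℓ) →
    let open CharZeroField F in
    let open FPS F in
    (lam α cc : Carrier) → ¬ (lam ≈ 1#) → ¬ (cc ≈ 0#) →
    (S : ℕ → Poly) → IsSheffer (gSeries lam α) (fSeries cc) S →
    (n : ℕ) → 1 ≤ n → (x : Carrier) →
    eval (S n) x ≈ rhs n lam α cc x
proposition8 F lam α cc lam≉1 _ S sheffer n@(suc m) _ x = begin
  eval (S n) x                            ≈⟨ eval-as-sum (S n) x M length≤M ⟩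
  sumTo M (λ j → coef (S n) j * x ^ᶜ j)   ≈⟨ Σ-cong< M (λ j j<M → *-congʳ (same-coefficients j j<M)) ⟩
  sumTo M (λ j → candidate n j * x ^ᶜ j)  ≈⟨ candidate-eval n M x n<M ⟩
  rhs n lam α cc x                        ∎
  where
  open CharZeroField F
  open Theory F
  open Proposition8Series lam α cc lam≉1
  open ≈-Reasoning
  open import Data.List using (length)
  import Data.Nat as ℕ
  open import Data.Nat.Properties using (m≤m+n; m≤n+m; n≤1+n; ≤-trans)
  M : ℕ
  M = suc (n ℕ.+ length (S n))
  n<M : n ℕ.< M
  n<M = s≤s (m≤m+n n _)
  length≤M : length (S n) ≤ M
  length≤M = ≤-trans (m≤n+m (length (S n)) n) (n≤1+n _)
  same-coefficients : ∀ j → j ℕ.< M → coef (S n) j ≈ candidate n j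
  same-coefficients = pairing-determines-coefficients M gfᵏ (S n) (candidate n) gfᵏ-triangular length≤M
    (λ k → trans (sheffer n k) (sym (candidate-sheffer m k M n<M)))
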